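{- Let $\mathbf{c}=(c_1,\dots,c_n)\in\mathbb{Z}_{>0}^n$ and $0<k<c_1+\cdots+c_n$. Then the volume of $\mathscr{R}_{k,\mathbf{c}}$ is \[ \operatorname{vol}(\mathscr{R}_{k,\mathbf{c}})=\frac{1}{(n-1)!}\sum_{\ell=0}^{k-1}B(\ell,\mathbf{c})\,A(n-1,k-\ell-1), \] where $B(\ell,\mathbf{c})$ is the number of ways of placing $\ell$ indistinguishable balls into $n$ boxes of capacities $c_1-1,\dots,c_n-1$ respectively, i.e. the number of integer vectors $(b_1,\dots,b_n)$ with $0\le b_i\le c_i-1$ and $\sum_i b_i=\ell$.
   Context: $\mathscr{R}_{k,\mathbf{c}}=\{x\in\mathbb{R}^n : 0\le x_i\le c_i \text{ for all } i,\ \sum_i x_i=k\}$, an $(n-1)$-dimensional lattice polytope under the hypothesis. Its volume $\operatorname{vol}$ is the $(n-1)$-dimensional volume measured relative to the lattice $\mathbb{Z}^n\cap\operatorname{aff}(\mathscr{R}_{k,\mathbf{c}})$ (so a unimodular simplex has volume $1/(n-1)!$); equivalently, it is the leading coefficient of the Ehrhart polynomial. $A(m,j)$ is the number of permutations of $[m]$ with exactly $j$ descents (positions $i\in[m-1]$ with $\tau(i)>\tau(i+1)$), with $A(0,0)=1$. -}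

module Defs where

open import Data.Nat using (ℕ; zero; suc; _+_; _*_; _∸_; _^_; _<ᵇ_; _≡ᵇ_; _!)
open import Data.Nat.Properties using (_!≢0)
open import Data.Bool using (Bool; true; false; if_then_else_)
open import Data.List using (List; []; _∷_; map; concatMap; length; filterᵇ; upTo; allFin)
open import Data.Nat.ListAction using (sum)
open import Data.Vec as V using (Vec; []; _∷_)
open import Data.Fin using (Fin)
open import Data.Integer using (+_)
open import Data.Rational using (ℚ; _/_) renaming (_+_ to _+ℚ_; _*_ to _*ℚ_)
import Data.Rational as Q

boundedVecs : ∀ {n} → Vec ℕ n → List (Vec ℕ n)
boundedVecs [] = [] ∷ []
boundedVecs (c ∷ cs) =
  concatMap (λ j → map (j ∷_) (boundedVecs cs)) (upTo (suc c))

countBounded : ∀ {n} → Vec ℕ n → ℕ → ℕ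
countBounded caps m = length (filterᵇ (λ b → V.sum b ≡ᵇ m) (boundedVecs caps))

B : ∀ {n} → ℕ → Vec ℕ n → ℕ
B ℓ c = countBounded (V.map (_∸ 1) c) ℓ

-- Number of lattice points of t·R_{k,c}
-- = #{x ∈ ℤⁿ : 0 ≤ xᵢ ≤ t cᵢ, Σ xᵢ = t k}.
ehrhartCount : ∀ {n} → Vec ℕ n → ℕ → ℕ → ℕ
ehrhartCount c k t = countBounded (V.map (t *_) c) (t * k)

insertAll : ℕ → List ℕ → List (List ℕ)
insertAll x [] = (x ∷ []) ∷ []
insertAll x (y ∷ ys) = (x ∷ y ∷ ys) ∷ map (y ∷_) (insertAll x ys)

perms : List ℕ → List (List ℕ)
perms [] = [] ∷ []
perms (x ∷ xs) = concatMap (insertAll x) (perms xs)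

descents : List ℕ → ℕ
descents [] = 0
descents (x ∷ []) = 0
descents (x ∷ y ∷ ys) = (if y <ᵇ x then 1 else 0) + descents (y ∷ ys)

A : ℕ → ℕ → ℕ
A m j = length (filterᵇ (λ τ → descents τ ≡ᵇ j) (perms (upTo m)))

ℕ→ℚ : ℕ → ℚ
ℕ→ℚ m = + m / 1

sumℚ : List ℚ → ℚ
sumℚ [] = Q.0ℚ
sumℚ (x ∷ xs) = x +ℚ sumℚ xs

powℚ : ℚ → ℕ → ℚ
powℚ q zero = Q.1ℚ
powℚ q (suc e) = q *ℚ powℚ q e

-- vol(R_{k,c}) = v (relative (n-1)-dimensional volume): the Ehrhart
-- function t ↦ #(tR ∩ ℤⁿ) is a polynomial of degree ≤ n-1 in t whose
-- coefficient of t^{n-1} is v.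
VolumeIs : ∀ {n} → Vec ℕ n → ℕ → ℚ → Set
VolumeIs {n} c k v =
  Σ (Fin (n ∸ 1) → ℚ) λ a →
    ∀ (t : ℕ) →
      ℕ→ℚ (ehrhartCount c k t)
        ≡ (v *ℚ powℚ (ℕ→ℚ t) (n ∸ 1))
          +ℚ sumℚ (map (λ i → a i *ℚ powℚ (ℕ→ℚ t) (Data.Fin.toℕ i)) (allFin (n ∸ 1)))
  where open import Data.Product using (Σ)
        open import Relation.Binary.PropositionalEquality using (_≡_)
        import Data.Fin

volumeFormula : ∀ {n} → Vec ℕ n → ℕ → ℚ
volumeFormula {n} c k =
  _/_ (+ sum (map (λ ℓ → B ℓ c * A (n ∸ 1) (k ∸ ℓ ∸ 1)) (upTo k)))
      ((n ∸ 1) !) {{(n ∸ 1) !≢0}}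

module Submission where

-- By inclusion–exclusion over the upper bounds, the number of lattice points of t R_{k,c}, n = D + 1, is
--   Σ_S (−1)^|S| C(t (k − c_S) − |S| + D, D),   c_S = Σ_{i ∈ S} cᵢ.
-- If k > c_S this binomial coefficient is, for every t, the polynomial (N + 1) ⋯ (N + D) / D! at N = t (k − c_S) − |S|
-- (because N ≥ −D), with leading coefficient (k − c_S)^D / D!; if k ≤ c_S and S ≠ ∅ it vanishes; and k < Σ cᵢ puts
-- S = [n] in the second case. So D! · vol = Σ_S (−1)^|S| (k − c_S)₊^D. Worpitzky's identity
-- x^D = Σ_j A(D, j) C(x − 1 − j + D, D), proved from the Eulerian recurrence obtained by inserting a new minimum into
-- permutations, writes (k − c_S)₊^D as a convolution of Eulerian numbers with binomial coefficients, and the same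
-- inclusion–exclusion read backwards turns Σ_S (−1)^|S| C(ℓ − c_S + D, D) into B(ℓ, c).

open import Data.Bool.Base using (Bool; true; false; if_then_else_; T)
open import Data.Empty using (⊥-elim)
open import Data.Fin.Base using (Fin; zero; suc; toℕ)
open import Data.Integer.Base as ℤ using (ℤ; +_; -[1+_]; +[1+_]; _+_; _*_; _-_; -_; _⊖_; _^_; +<+; -<+)
open import Data.Integer.Properties
open import Data.Integer.Tactic.RingSolver using (solve-∀)
open import Data.List.Base as List using (List; []; _∷_; _++_; map; concatMap; length; filterᵇ; upTo; allFin)
import Data.List.Properties as List
open import Data.List.Relation.Unary.All as All using ([]; _∷_)
import Data.List.Relation.Unary.All.Properties as All
open import Data.Nat using (ℕ; _<_)
open import Data.Nat.Base as ℕ using (zero; suc; _!)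
import Data.Nat.ListAction as ℕ
import Data.Nat.ListAction.Properties as ℕₚ
import Data.Nat.Properties as ℕₚ
open import Data.Nat.Tactic.RingSolver using () renaming (solve-∀ to ℕ-solve-∀)
open import Data.Product.Base using (Σ; _×_; _,_)
open import Data.Rational.Base as ℚ using (ℚ)
import Data.Rational.Properties as ℚₚ
open import Data.Rational.Solver using () renaming (module +-*-Solver to ℚ-Solver)
import Data.Rational.Unnormalised.Base as ℚᵘ
import Data.Rational.Unnormalised.Properties as ℚᵘₚ
open import Data.Sum.Base using (_⊎_; inj₁; inj₂)
open import Data.Unit.Base using (tt)
open import Data.Vec using (Vec; sum)
open import Data.Vec.Base as Vec using ([]; _∷_)
open import Data.Vec.Functional as Vector using (Vector)
import Data.Vec.Properties as Vec
open import Data.Vec.Relation.Unary.All using (All; []; _∷_)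
open import Relation.Binary.PropositionalEquality
open ≡-Reasoning

open import Defs

import Algebra.Properties.Semiring.Sum +-*-semiring as FinSum

∑ : ℕ → (ℕ → ℤ) → ℤ
∑ zero    f = + 0
∑ (suc m) f = ∑ m f + f m

infix 5 ∑
syntax ∑ m (λ j → e) = ∑[ j < m ] e

∑-cong-< : ∀ m {f g : ℕ → ℤ} → (∀ j → j ℕ.< m → f j ≡ g j) → ∑ m f ≡ ∑ m g
∑-cong-< zero    eq = refl
∑-cong-< (suc m) eq = cong₂ _+_ (∑-cong-< m (λ j j<m → eq j (ℕₚ.m<n⇒m<1+n j<m))) (eq m ℕₚ.≤-refl)

∑-cong : ∀ m {f g : ℕ → ℤ} → (∀ j → f j ≡ g j) → ∑ m f ≡ ∑ m g
∑-cong m eq = ∑-cong-< m (λ j _ → eq j)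

∑-zero : ∀ m → ∑[ j < m ] + 0 ≡ + 0
∑-zero zero    = refl
∑-zero (suc m) = trans (+-identityʳ _) (∑-zero m)

∑-head : ∀ m (f : ℕ → ℤ) → ∑ (suc m) f ≡ f 0 + (∑[ j < m ] f (suc j))
∑-head zero    f = trans (+-identityˡ (f 0)) (sym (+-identityʳ (f 0)))
∑-head (suc m) f = begin
  ∑ (suc m) f + f (suc m)                    ≡⟨ cong (_+ f (suc m)) (∑-head m f) ⟩
  f 0 + (∑[ j < m ] f (suc j)) + f (suc m)   ≡⟨ +-assoc (f 0) _ _ ⟩
  f 0 + (∑[ j < suc m ] f (suc j))           ∎

∑-distrib-+ : ∀ m (f g : ℕ → ℤ) → ∑[ j < m ] (f j + g j) ≡ ∑ m f + ∑ m g
∑-distrib-+ zero    f g = refl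
∑-distrib-+ (suc m) f g = begin
  (∑[ j < m ] (f j + g j)) + (f m + g m) ≡⟨ cong (_+ (f m + g m)) (∑-distrib-+ m f g) ⟩
  ∑ m f + ∑ m g + (f m + g m)            ≡⟨ middle-swap (∑ m f) (∑ m g) (f m) (g m) ⟩
  ∑ m f + f m + (∑ m g + g m)            ∎
  where
  middle-swap : ∀ a b c d → a + b + (c + d) ≡ a + c + (b + d)
  middle-swap = solve-∀

*-distribˡ-∑ : ∀ m a (f : ℕ → ℤ) → a * ∑ m f ≡ ∑[ j < m ] a * f j
*-distribˡ-∑ zero    a f = *-zeroʳ a
*-distribˡ-∑ (suc m) a f = trans (*-distribˡ-+ a (∑ m f) (f m)) (cong (_+ a * f m) (*-distribˡ-∑ m a f))

∑-distrib-- : ∀ m (f g : ℕ → ℤ) → ∑[ j < m ] (f j - g j) ≡ ∑ m f - ∑ m g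
∑-distrib-- zero    f g = refl
∑-distrib-- (suc m) f g = begin
  (∑[ j < m ] (f j - g j)) + (f m - g m) ≡⟨ cong (_+ (f m - g m)) (∑-distrib-- m f g) ⟩
  ∑ m f - ∑ m g + (f m - g m)            ≡⟨ regroup (∑ m f) (∑ m g) (f m) (g m) ⟩
  ∑ m f + f m - (∑ m g + g m)            ∎
  where
  regroup : ∀ a b c d → a - b + (c - d) ≡ a + c - (b + d)
  regroup = solve-∀

∑-reverse : ∀ m (f : ℕ → ℤ) → ∑ m f ≡ ∑[ j < m ] f (m ℕ.∸ suc j)
∑-reverse zero    f = refl
∑-reverse (suc m) f = begin
  ∑ m f + f m                               ≡⟨ cong (_+ f m) (∑-reverse m f) ⟩
  (∑[ j < m ] f (m ℕ.∸ suc j)) + f m        ≡⟨ +-comm _ (f m) ⟩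
  f m + (∑[ j < m ] f (m ℕ.∸ suc j))        ≡⟨ ∑-head m (λ j → f (suc m ℕ.∸ suc j)) ⟨
  ∑[ j < suc m ] f (suc m ℕ.∸ suc j)        ∎

Δ : ℕ → (ℤ → ℤ) → ℤ → ℤ
Δ b f x = f x - f (x - + b)

Δs : ∀ {m} → Vec ℕ m → (ℤ → ℤ) → ℤ → ℤ
Δs []       f = f
Δs (b ∷ bs) f = Δs bs (Δ b f)

Δs-cong : ∀ {m} (bs : Vec ℕ m) {f g : ℤ → ℤ} → (∀ x → f x ≡ g x) → ∀ x → Δs bs f x ≡ Δs bs g x
Δs-cong []       eq x = eq x
Δs-cong (b ∷ bs) eq x = Δs-cong bs (λ y → cong₂ _-_ (eq y) (eq (y - + b))) x

Δs-zero : ∀ {m} (bs : Vec ℕ m) x → Δs bs (λ _ → + 0) x ≡ + 0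
Δs-zero []       x = refl
Δs-zero (b ∷ bs) x = Δs-zero bs x

Δs-distrib-+ : ∀ {m} (bs : Vec ℕ m) (f g : ℤ → ℤ) x → Δs bs (λ y → f y + g y) x ≡ Δs bs f x + Δs bs g x
Δs-distrib-+ []       f g x = refl
Δs-distrib-+ (b ∷ bs) f g x =
  trans (Δs-cong bs (λ y → regroup (f y) (g y) (f (y - + b)) (g (y - + b))) x) (Δs-distrib-+ bs (Δ b f) (Δ b g) x)
  where
  regroup : ∀ a b c d → a + b - (c + d) ≡ a - c + (b - d)
  regroup = solve-∀

Δs-distrib-- : ∀ {m} (bs : Vec ℕ m) (f g : ℤ → ℤ) x → Δs bs (λ y → f y - g y) x ≡ Δs bs f x - Δs bs g x
Δs-distrib-- []       f g x = refl
Δs-distrib-- (b ∷ bs) f g x =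
  trans (Δs-cong bs (λ y → regroup (f y) (g y) (f (y - + b)) (g (y - + b))) x) (Δs-distrib-- bs (Δ b f) (Δ b g) x)
  where
  regroup : ∀ a b c d → a - b - (c - d) ≡ a - c - (b - d)
  regroup = solve-∀

Δs-∑ : ∀ {m} (bs : Vec ℕ m) p (F : ℕ → ℤ → ℤ) x → Δs bs (λ y → ∑[ j < p ] F j y) x ≡ ∑[ j < p ] Δs bs (F j) x
Δs-∑ bs zero    F x = Δs-zero bs x
Δs-∑ bs (suc p) F x =
  trans (Δs-distrib-+ bs (λ y → ∑[ j < p ] F j y) (F p) x) (cong (_+ Δs bs (F p) x) (Δs-∑ bs p F x))

Δs-shift : ∀ {m} (bs : Vec ℕ m) (f : ℤ → ℤ) s x → Δs bs (λ y → f (y - + s)) x ≡ Δs bs f (x - + s)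
Δs-shift []       f s x = refl
Δs-shift (b ∷ bs) f s x =
  trans (Δs-cong bs (λ y → cong (λ z → f (y - + s) - f z) (swap-subtrahends y (+ b) (+ s))) x) (Δs-shift bs (Δ b f) s x)
  where
  swap-subtrahends : ∀ y b s → y - b - s ≡ y - s - b
  swap-subtrahends = solve-∀

Δs-Δ : ∀ {m} (bs : Vec ℕ m) b (f : ℤ → ℤ) x → Δs bs (Δ b f) x ≡ Δ b (Δs bs f) x
Δs-Δ bs b f x = trans (Δs-distrib-- bs f (λ y → f (y - + b)) x) (cong (λ z → Δs bs f x - z) (Δs-shift bs f b x))

δ : ℤ → ℤ
δ (+ zero)  = + 1
δ +[1+ n ]  = + 0
δ -[1+ n ]  = + 0

prefixSum : (ℤ → ℤ) → ℤ → ℤ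
prefixSum f (+ n)    = ∑[ j < suc n ] f (+ j)
prefixSum f -[1+ n ] = + 0

-- The number of ways to write x as an ordered sum of L naturals: C(x + L − 1, L − 1) for L > 0.
compositions : ℕ → ℤ → ℤ
compositions zero    = δ
compositions (suc L) = prefixSum (compositions L)

boundedCount : ∀ {m} → Vec ℕ m → ℤ → ℤ
boundedCount []       = δ
boundedCount (b ∷ bs) x = ∑[ j < suc b ] boundedCount bs (x - + j)

VanishesOnNegatives : (ℤ → ℤ) → Set
VanishesOnNegatives f = ∀ n → f -[1+ n ] ≡ + 0

vanishes-below-zero : ∀ f → VanishesOnNegatives f → ∀ {y} → y ℤ.< + 0 → f y ≡ + 0
vanishes-below-zero f f<0≡0 { -[1+ n ]} _ = f<0≡0 n
vanishes-below-zero f f<0≡0 {+ n}      (+<+ ())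

compositions-vanishes : ∀ L → VanishesOnNegatives (compositions L)
compositions-vanishes zero    n = refl
compositions-vanishes (suc L) n = refl

1+n-1≡n : ∀ n → + suc n - + 1 ≡ + n
1+n-1≡n n = trans (m-n≡m⊖n (suc n) 1) (⊖-≥ (ℕ.s≤s ℕ.z≤n))

prefixSum-step : ∀ f → VanishesOnNegatives f → ∀ x → prefixSum f x ≡ prefixSum f (x - + 1) + f x
prefixSum-step f f<0≡0 (+ zero)  = refl
prefixSum-step f f<0≡0 +[1+ n ]  = cong (λ z → prefixSum f z + f +[1+ n ]) (sym (1+n-1≡n n))
prefixSum-step f f<0≡0 -[1+ n ]  =
  sym (trans (cong (λ z → prefixSum f z + f -[1+ n ]) (neg-minus-pos n 1)) (trans (+-identityˡ _) (f<0≡0 n)))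

∑-shifts≡Δ-prefixSum : ∀ f → VanishesOnNegatives f → ∀ m x → ∑[ j < m ] f (x - + j) ≡ Δ m (prefixSum f) x
∑-shifts≡Δ-prefixSum f f<0≡0 zero x =
  sym (trans (cong (λ z → prefixSum f x - prefixSum f z) (+-identityʳ x)) (+-inverseʳ (prefixSum f x)))
∑-shifts≡Δ-prefixSum f f<0≡0 (suc m) x = begin
  (∑[ j < m ] f (x - + j)) + f (x - + m)    ≡⟨ cong (_+ f (x - + m)) (∑-shifts≡Δ-prefixSum f f<0≡0 m x) ⟩
  F x - F (x - + m) + f (x - + m)          ≡⟨ cong (λ z → F x - z + f (x - + m)) (prefixSum-step f f<0≡0 (x - + m)) ⟩
  F x - (F (x - + m - + 1) + f (x - + m)) + f (x - + m)  ≡⟨ cancel (F x) _ (f (x - + m)) ⟩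
  F x - F (x - + m - + 1)                  ≡⟨ cong (λ z → F x - F z) (subtract-suc x m) ⟩
  F x - F (x - + suc m)                    ∎
  where
  F = prefixSum f
  cancel : ∀ a b c → a - (b + c) + c ≡ a - b
  cancel = solve-∀
  subtract-suc : ∀ x m → x - + m - + 1 ≡ x - + suc m
  subtract-suc x m = trans (regroup x (+ m)) (cong (λ z → x - z) (sym (pos-+ 1 m)))
    where
    regroup : ∀ x m → x - m - + 1 ≡ x - (+ 1 + m)
    regroup = solve-∀

boundedCount≡Δs-compositions : ∀ {m} (bs : Vec ℕ m) x → boundedCount bs x ≡ Δs (Vec.map suc bs) (compositions m) x
boundedCount≡Δs-compositions []             x = refl
boundedCount≡Δs-compositions {suc m} (b ∷ bs) x = begin
  ∑[ j < suc b ] boundedCount bs (x - + j)                 ≡⟨ ∑-cong (suc b) (λ j → boundedCount≡Δs-compositions bs (x - + j)) ⟩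
  ∑[ j < suc b ] Δs cs (compositions m) (x - + j)           ≡⟨ ∑-cong (suc b) (λ j → Δs-shift cs (compositions m) j x) ⟨
  ∑[ j < suc b ] Δs cs (λ y → compositions m (y - + j)) x   ≡⟨ Δs-∑ cs (suc b) (λ j y → compositions m (y - + j)) x ⟨
  Δs cs (λ y → ∑[ j < suc b ] compositions m (y - + j)) x   ≡⟨ Δs-cong cs (∑-shifts≡Δ-prefixSum (compositions m) (compositions-vanishes m) (suc b)) x ⟩
  Δs cs (Δ (suc b) (compositions (suc m))) x               ∎
  where
  cs = Vec.map suc bs

rising : ℕ → ℤ → ℤ
rising zero    N = + 1
rising (suc D) N = rising D N * (N + + suc D)

rising-suc-pred : ∀ D N → rising (suc D) (N - + 1) ≡ N * rising D N
rising-suc-pred zero    N = base N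
  where
  base : ∀ N → + 1 * (N - + 1 + + 1) ≡ N * + 1
  base = solve-∀
rising-suc-pred (suc D) N = begin
  rising (suc D) (N - + 1) * (N - + 1 + + suc (suc D)) ≡⟨ cong₂ (λ a b → a * (N - + 1 + b)) (rising-suc-pred D N) (pos-+ 1 (suc D)) ⟩
  N * rising D N * (N - + 1 + (+ 1 + + suc D))         ≡⟨ regroup N (rising D N) (+ suc D) ⟩
  N * (rising D N * (N + + suc D))                     ∎
  where
  regroup : ∀ N r d → N * r * (N - + 1 + (+ 1 + d)) ≡ N * (r * (N + d))
  regroup = solve-∀

rising-vanishes : ∀ D m → m ℕ.< D → rising D -[1+ m ] ≡ + 0
rising-vanishes (suc D) m m<1+D with ℕₚ.m<1+n⇒m<n∨m≡n m<1+D
... | inj₁ m<D  = trans (cong (_* (-[1+ m ] + + suc D)) (rising-vanishes D m m<D)) (*-zeroˡ (-[1+ m ] + + suc D))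
... | inj₂ refl = trans (cong (rising D -[1+ m ] *_) (+-inverseˡ (+ suc m))) (*-zeroʳ (rising D -[1+ m ]))

rising-suc≡∑ : ∀ D m → rising (suc D) (+ m) ≡ ∑[ j < suc m ] + suc D * rising D (+ j)
rising-suc≡∑ D zero    = regroup (rising D (+ 0)) (+ suc D)
  where
  regroup : ∀ r d → r * (+ 0 + d) ≡ + 0 + d * r
  regroup = solve-∀
rising-suc≡∑ D (suc m) = begin
  rising D x * (x + + suc D)                                ≡⟨ expand (rising D x) x (+ suc D) ⟩
  x * rising D x + + suc D * rising D x                     ≡⟨ cong (_+ + suc D * rising D x) shifted ⟨
  rising (suc D) (+ m) + + suc D * rising D x               ≡⟨ cong (_+ + suc D * rising D x) (rising-suc≡∑ D m) ⟩
  (∑[ j < suc m ] + suc D * rising D (+ j)) + + suc D * rising D x ∎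
  where
  x = + suc m
  expand : ∀ r x d → r * (x + d) ≡ x * r + d * r
  expand = solve-∀
  shifted : rising (suc D) (+ m) ≡ x * rising D x
  shifted = trans (cong (rising (suc D)) (sym (1+n-1≡n m))) (rising-suc-pred D x)

rising≡!*compositions : ∀ D m → rising D (+ m) ≡ + (D !) * compositions (suc D) (+ m)
rising≡!*compositions zero    m = sym (trans (*-identityˡ _) (trans (∑-head m (λ j → δ (+ j))) (cong (λ z → + 1 + z) (∑-zero m))))
rising≡!*compositions (suc D) m = begin
  rising (suc D) (+ m)                                         ≡⟨ rising-suc≡∑ D m ⟩
  ∑[ j < suc m ] + suc D * rising D (+ j)                      ≡⟨ *-distribˡ-∑ (suc m) (+ suc D) (λ j → rising D (+ j)) ⟨
  + suc D * (∑[ j < suc m ] rising D (+ j))                    ≡⟨ cong (+ suc D *_) (∑-cong (suc m) (λ j → rising≡!*compositions D j)) ⟩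
  + suc D * (∑[ j < suc m ] + (D !) * compositions (suc D) (+ j)) ≡⟨ cong (+ suc D *_) (*-distribˡ-∑ (suc m) (+ (D !)) _) ⟨
  + suc D * (+ (D !) * compositions (suc (suc D)) (+ m))       ≡⟨ *-assoc (+ suc D) (+ (D !)) _ ⟨
  + suc D * + (D !) * compositions (suc (suc D)) (+ m)         ≡⟨ cong (_* compositions (suc (suc D)) (+ m)) (pos-* (suc D) (D !)) ⟨
  + (suc D !) * compositions (suc (suc D)) (+ m)               ∎

rising≡!*compositions-⊖ : ∀ D y r → r ℕ.≤ D → rising D (y ⊖ r) ≡ + (D !) * compositions (suc D) (y ⊖ r)
rising≡!*compositions-⊖ D y r r≤D with ℕₚ.≤-<-connex r y
... | inj₁ r≤y rewrite ⊖-≥ r≤y = rising≡!*compositions D (y ℕ.∸ r)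
... | inj₂ y<r rewrite ⊖-< y<r = negative (r ℕ.∸ y) refl
  where
  negative : ∀ k → r ℕ.∸ y ≡ k → rising D (- (+ k)) ≡ + (D !) * compositions (suc D) (- (+ k))
  negative zero    r∸y≡0 = ⊥-elim (ℕₚ.<⇒≱ y<r (ℕₚ.m∸n≡0⇒m≤n r∸y≡0))
  negative (suc k) r∸y≡k = trans (rising-vanishes D k k<D) (sym (*-zeroʳ (+ (D !))))
    where
    k<D : k ℕ.< D
    k<D = ℕₚ.<-≤-trans (subst (k ℕ.<_) (sym r∸y≡k) ℕₚ.≤-refl) (ℕₚ.≤-trans (ℕₚ.m∸n≤m r y) r≤D)

eval : ∀ {d} → Vector ℤ d → ℤ → ℤ
eval b x = FinSum.sum (λ i → b i * x ^ toℕ i)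

eval-∷ : ∀ {d} (b : Vector ℤ (suc d)) x → eval b x ≡ Vector.head b + x * eval (Vector.tail b) x
eval-∷ {d} b x = cong₂ _+_ (*-identityʳ (b zero)) (begin
  FinSum.sum (λ i → b (suc i) * (x * x ^ toℕ i)) ≡⟨ FinSum.sum-cong-≗ (λ i → x*-commute (b (suc i)) x (x ^ toℕ i)) ⟩
  FinSum.sum (λ i → x * (b (suc i) * x ^ toℕ i)) ≡⟨ FinSum.*-distribˡ-sum {d} x (λ i → b (suc i) * x ^ toℕ i) ⟨
  x * eval (Vector.tail b) x                     ∎)
  where
  x*-commute : ∀ b x p → b * (x * p) ≡ x * (b * p)
  x*-commute = solve-∀

eval-zero : ∀ {d} x → eval {d} (λ _ → + 0) x ≡ + 0
eval-zero {d} x = trans (FinSum.sum-cong-≗ {d} (λ i → *-zeroˡ (x ^ toℕ i))) (FinSum.sum-replicate-zero d)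

eval-+ : ∀ {d} (b c : Vector ℤ d) x → eval (λ i → b i + c i) x ≡ eval b x + eval c x
eval-+ b c x = trans (FinSum.sum-cong-≗ (λ i → *-distribʳ-+ (x ^ toℕ i) (b i) (c i)))
  (FinSum.∑-distrib-+ (λ i → b i * x ^ toℕ i) (λ i → c i * x ^ toℕ i))

eval-*ˡ : ∀ {d} s (b : Vector ℤ d) x → eval (λ i → s * b i) x ≡ s * eval b x
eval-*ˡ s b x = trans (FinSum.sum-cong-≗ (λ i → *-assoc s (b i) (x ^ toℕ i))) (sym (FinSum.*-distribˡ-sum s (λ i → b i * x ^ toℕ i)))

eval-- : ∀ {d} (b c : Vector ℤ d) x → eval (λ i → b i - c i) x ≡ eval b x - eval c x
eval-- b c x = begin
  eval (λ i → b i - c i) x                                 ≡⟨ trans (FinSum.sum-cong-≗ (λ i → split (b i) (c i) (x ^ toℕ i))) (FinSum.∑-distrib-+ (λ i → b i * x ^ toℕ i) (λ i → - + 1 * (c i * x ^ toℕ i))) ⟩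
  eval b x + FinSum.sum (λ i → - + 1 * (c i * x ^ toℕ i))  ≡⟨ cong (λ z → eval b x + z) (FinSum.*-distribˡ-sum (- + 1) (λ i → c i * x ^ toℕ i)) ⟨
  eval b x + - + 1 * eval c x                              ≡⟨ cong (λ z → eval b x + z) (-1*i≡-i (eval c x)) ⟩
  eval b x - eval c x                                      ∎
  where
  split : ∀ b c p → (b - c) * p ≡ b * p + - + 1 * (c * p)
  split = solve-∀

_∷ʳ_ : ∀ {d} → Vector ℤ d → ℤ → Vector ℤ (suc d)
_∷ʳ_ {zero}  b c _       = c
_∷ʳ_ {suc d} b c zero    = b zero
_∷ʳ_ {suc d} b c (suc i) = (Vector.tail b ∷ʳ c) i

eval-∷ʳ : ∀ {d} (b : Vector ℤ d) c x → eval (b ∷ʳ c) x ≡ eval b x + c * x ^ d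
eval-∷ʳ {zero}  b c x = constant c
  where
  constant : ∀ c → c * + 1 + + 0 ≡ + 0 + c * + 1
  constant = solve-∀
eval-∷ʳ {suc d} b c x = begin
  eval (b ∷ʳ c) x                                        ≡⟨ eval-∷ (b ∷ʳ c) x ⟩
  b zero + x * eval (Vector.tail b ∷ʳ c) x               ≡⟨ cong (λ z → b zero + x * z) (eval-∷ʳ (Vector.tail b) c x) ⟩
  b zero + x * (eval (Vector.tail b) x + c * x ^ d)      ≡⟨ regroup (b zero) x (eval (Vector.tail b) x) c (x ^ d) ⟩
  b zero + x * eval (Vector.tail b) x + c * (x * x ^ d)  ≡⟨ cong (_+ c * (x * x ^ d)) (eval-∷ b x) ⟨
  eval b x + c * x ^ suc d                               ∎
  where
  regroup : ∀ b₀ x e c p → b₀ + x * (e + c * p) ≡ b₀ + x * e + c * (x * p)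
  regroup = solve-∀

record IsPoly (d : ℕ) (v : ℤ) (f : ℕ → ℤ) : Set where
  constructor isPoly
  field
    lower  : Vector ℤ d
    agrees : ∀ t → f t ≡ v * (+ t) ^ d + eval lower (+ t)

IsPoly-cong : ∀ {d v} {f g : ℕ → ℤ} → (∀ t → f t ≡ g t) → IsPoly d v f → IsPoly d v g
IsPoly-cong f≗g (isPoly b p) = isPoly b (λ t → trans (sym (f≗g t)) (p t))

IsPoly-zero : ∀ d → IsPoly d (+ 0) (λ _ → + 0)
IsPoly-zero d = isPoly (λ _ → + 0) (λ t → sym (begin
  + 0 * (+ t) ^ d + eval {d} (λ _ → + 0) (+ t) ≡⟨ cong (λ z → + 0 * (+ t) ^ d + z) (eval-zero {d} (+ t)) ⟩
  + 0 * (+ t) ^ d + + 0                        ≡⟨ +-identityʳ _ ⟩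
  + 0 * (+ t) ^ d                              ≡⟨ *-zeroˡ ((+ t) ^ d) ⟩
  + 0                                          ∎))

IsPoly-one : IsPoly 0 (+ 1) (λ _ → + 1)
IsPoly-one = isPoly (λ ()) (λ t → refl)

IsPoly-- : ∀ {d v w} {f g : ℕ → ℤ} → IsPoly d v f → IsPoly d w g → IsPoly d (v - w) (λ t → f t - g t)
IsPoly-- {d} {v} {w} {f} {g} (isPoly b p) (isPoly c q) = isPoly (λ i → b i - c i) (λ t → begin
  f t - g t                                                        ≡⟨ cong₂ _-_ (p t) (q t) ⟩
  v * (+ t) ^ d + eval b (+ t) - (w * (+ t) ^ d + eval c (+ t))    ≡⟨ regroup v w ((+ t) ^ d) _ _ ⟩
  (v - w) * (+ t) ^ d + (eval b (+ t) - eval c (+ t))              ≡⟨ cong (λ z → (v - w) * (+ t) ^ d + z) (eval-- b c (+ t)) ⟨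
  (v - w) * (+ t) ^ d + eval (λ i → b i - c i) (+ t)               ∎)
  where
  regroup : ∀ v w p e f → v * p + e - (w * p + f) ≡ (v - w) * p + (e - f)
  regroup = solve-∀

IsPoly-*-linear : ∀ {d v} {f : ℕ → ℤ} → IsPoly d v f → ∀ w e → IsPoly (suc d) (v * w) (λ t → f t * (w * + t + e))
IsPoly-*-linear {d} {v} {f} (isPoly b p) w e = isPoly b′ (λ t → begin
  f t * (w * + t + e)                                                      ≡⟨ cong (_* (w * + t + e)) (p t) ⟩
  (v * (+ t) ^ d + eval b (+ t)) * (w * + t + e)                          ≡⟨ expand v ((+ t) ^ d) (eval b (+ t)) w (+ t) e ⟩
  v * w * (+ t * (+ t) ^ d) + (+ t * (w * eval b (+ t)) + (e * eval b (+ t) + v * e * (+ t) ^ d)) ≡⟨ cong (λ z → v * w * (+ t) ^ suc d + z) (eval-b′ (+ t)) ⟨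
  v * w * (+ t) ^ suc d + eval b′ (+ t)                                     ∎)
  where
  b′ : Vector ℤ (suc d)
  b′ i = (+ 0 Vector.∷ (λ j → w * b j)) i + ((λ j → e * b j) ∷ʳ (v * e)) i
  expand : ∀ v p E w x e → (v * p + E) * (w * x + e) ≡ v * w * (x * p) + (x * (w * E) + (e * E + v * e * p))
  expand = solve-∀
  eval-b′ : ∀ x → eval b′ x ≡ x * (w * eval b x) + (e * eval b x + v * e * x ^ d)
  eval-b′ x = begin
    eval b′ x                                                           ≡⟨ eval-+ (+ 0 Vector.∷ (λ j → w * b j)) ((λ j → e * b j) ∷ʳ (v * e)) x ⟩
    eval (+ 0 Vector.∷ (λ j → w * b j)) x + eval ((λ j → e * b j) ∷ʳ (v * e)) x ≡⟨ cong₂ _+_ (eval-∷ (+ 0 Vector.∷ (λ j → w * b j)) x) (eval-∷ʳ (λ j → e * b j) (v * e) x) ⟩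
    + 0 + x * eval (λ j → w * b j) x + (eval (λ j → e * b j) x + v * e * x ^ d) ≡⟨ cong₂ (λ y z → + 0 + x * y + (z + v * e * x ^ d)) (eval-*ˡ w b x) (eval-*ˡ e b x) ⟩
    + 0 + x * (w * eval b x) + (e * eval b x + v * e * x ^ d)          ≡⟨ cong (_+ (e * eval b x + v * e * x ^ d)) (+-identityˡ (x * (w * eval b x))) ⟩
    x * (w * eval b x) + (e * eval b x + v * e * x ^ d)                ∎

rising-isPoly : ∀ D a r → IsPoly D (a ^ D) (λ t → rising D (+ t * a - + r))
rising-isPoly zero    a r = IsPoly-one
rising-isPoly (suc D) a r =
  subst (λ v → IsPoly (suc D) v (λ t → rising (suc D) (+ t * a - + r))) (*-comm (a ^ D) a)
    (IsPoly-cong (λ t → cong (rising D (+ t * a - + r) *_) (regroup a (+ t) (+ suc D) (+ r)))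
      (IsPoly-*-linear (rising-isPoly D a r) a (+ suc D - + r)))
  where
  regroup : ∀ a t d r → a * t + (d - r) ≡ t * a - r + d
  regroup = solve-∀

-- Polynomiality of the lattice-point count

truncatedPower : ℕ → ℤ → ℤ
truncatedPower D (+ zero)  = + 0
truncatedPower D +[1+ n ]  = +[1+ n ] ^ D
truncatedPower D -[1+ n ]  = + 0

-- D! times the inclusion–exclusion sum over the dilated bounds t cᵢ, taken at t a − r; for c of length D + 1,
-- a = k and r = 0 it is D! · #(t R_{k,c} ∩ ℤⁿ).
dilatedCount : ℕ → ∀ {m} → Vec ℕ m → ℤ → ℕ → ℕ → ℤ
dilatedCount D c a r t = + (D !) * Δs (Vec.map (λ x → suc (t ℕ.* x)) c) (compositions (suc D)) (+ t * a - + r)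

dilatedCount-[]-pos : ∀ D n r → r ℕ.≤ D → IsPoly D (+[1+ n ] ^ D) (dilatedCount D [] +[1+ n ] r)
dilatedCount-[]-pos D n r r≤D = IsPoly-cong agree (rising-isPoly D +[1+ n ] r)
  where
  argument : ∀ t → + t * +[1+ n ] - + r ≡ (t ℕ.* suc n) ⊖ r
  argument t = trans (cong (_- + r) (sym (pos-* t (suc n)))) (m-n≡m⊖n (t ℕ.* suc n) r)
  agree : ∀ t → rising D (+ t * +[1+ n ] - + r) ≡ dilatedCount D [] +[1+ n ] r t
  agree t = begin
    rising D (+ t * +[1+ n ] - + r)                         ≡⟨ cong (rising D) (argument t) ⟩
    rising D ((t ℕ.* suc n) ⊖ r)                            ≡⟨ rising≡!*compositions-⊖ D (t ℕ.* suc n) r r≤D ⟩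
    + (D !) * compositions (suc D) ((t ℕ.* suc n) ⊖ r)     ≡⟨ cong (λ z → + (D !) * compositions (suc D) z) (argument t) ⟨
    dilatedCount D [] +[1+ n ] r t                         ∎

dilatedCount-[]-nonpos : ∀ D a s → a ℤ.≤ + 0 → IsPoly D (+ 0) (dilatedCount D [] a (suc s))
dilatedCount-[]-nonpos D a s a≤0 = IsPoly-cong vanish (IsPoly-zero D)
  where
  vanish : ∀ t → + 0 ≡ dilatedCount D [] a (suc s) t
  vanish t = sym (trans (cong (+ (D !) *_) (vanishes-below-zero (compositions (suc D)) (compositions-vanishes (suc D)) argument<0)) (*-zeroʳ (+ (D !))))
    where
    ta≤0 : + t * a ℤ.≤ + 0
    ta≤0 = subst (+ t * a ℤ.≤_) (*-zeroʳ (+ t)) (*-monoˡ-≤-nonNeg (+ t) a≤0)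
    argument<0 : + t * a - + suc s ℤ.< + 0
    argument<0 = +-mono-≤-< ta≤0 -<+

SubtractionBound : ℕ → ℕ → ℤ → ℕ → Set
SubtractionBound D k a s = k ℕ.≤ D ⊎ (k ≡ suc D × a ℤ.< + s)

dilatedCount-[] : ∀ D a r → (+ 0 ℤ.< a ⊎ 1 ℕ.≤ r) → SubtractionBound D r a 0 →
                  IsPoly D (truncatedPower D a) (dilatedCount D [] a r)
dilatedCount-[] D +[1+ n ] r       _                (inj₁ r≤D)        = dilatedCount-[]-pos D n r r≤D
dilatedCount-[] D +[1+ n ] r       _                (inj₂ (_ , +<+ ()))
dilatedCount-[] D (+ zero) zero    (inj₁ (+<+ ()))  _
dilatedCount-[] D (+ zero) zero    (inj₂ ())        _
dilatedCount-[] D (+ zero) (suc s) _                _                 = dilatedCount-[]-nonpos D (+ 0) s ≤-refl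
dilatedCount-[] D -[1+ n ] zero    (inj₁ ())        _
dilatedCount-[] D -[1+ n ] zero    (inj₂ ())        _
dilatedCount-[] D -[1+ n ] (suc s) _                _                 = dilatedCount-[]-nonpos D -[1+ n ] s ℤ.-≤+

dilatedCount-∷ : ∀ D c₀ {m} (c : Vec ℕ m) a r t →
                 dilatedCount D (c₀ ∷ c) a r t ≡ dilatedCount D c a r t - dilatedCount D c (a - + c₀) (suc r) t
dilatedCount-∷ D c₀ c a r t = begin
  + (D !) * Δs cs (Δ (suc (t ℕ.* c₀)) G) N                          ≡⟨ cong (+ (D !) *_) (Δs-Δ cs (suc (t ℕ.* c₀)) G N) ⟩
  + (D !) * (Δs cs G N - Δs cs G (N - + suc (t ℕ.* c₀)))            ≡⟨ cong (λ z → + (D !) * (Δs cs G N - Δs cs G z)) shifted ⟩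
  + (D !) * (Δs cs G N - Δs cs G (+ t * (a - + c₀) - + suc r))      ≡⟨ *-distribˡ-- (+ (D !)) _ _ ⟩
  dilatedCount D c a r t - dilatedCount D c (a - + c₀) (suc r) t   ∎
  where
  cs = Vec.map (λ x → suc (t ℕ.* x)) c
  G = compositions (suc D)
  N = + t * a - + r
  *-distribˡ-- : ∀ d x y → d * (x - y) ≡ d * x - d * y
  *-distribˡ-- = solve-∀
  regroup : ∀ t a r c → t * a - r - (+ 1 + t * c) ≡ t * (a - c) - (+ 1 + r)
  regroup = solve-∀
  shifted : N - + suc (t ℕ.* c₀) ≡ + t * (a - + c₀) - + suc r
  shifted = begin
    N - + suc (t ℕ.* c₀)             ≡⟨ cong (λ z → N - z) (trans (pos-+ 1 (t ℕ.* c₀)) (cong (λ z → + 1 + z) (pos-* t c₀))) ⟩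
    N - (+ 1 + + t * + c₀)           ≡⟨ regroup (+ t) a (+ r) (+ c₀) ⟩
    + t * (a - + c₀) - (+ 1 + + r)   ≡⟨ cong (λ z → + t * (a - + c₀) - z) (pos-+ 1 r) ⟨
    + t * (a - + c₀) - + suc r       ∎

-- The hypotheses are an invariant of the recursion on c: at each leaf either a > 0 and r ≤ D, so that
-- t a - r ≥ - D and D! · compositions (D + 1) agrees with a rising factorial, or a ≤ 0 < r and the term vanishes.
dilatedCount-isPoly : ∀ D {m} (c : Vec ℕ m) a r → (+ 0 ℤ.< a ⊎ 1 ℕ.≤ r) → SubtractionBound D (r ℕ.+ m) a (sum c) →
                      IsPoly D (Δs c (truncatedPower D) a) (dilatedCount D c a r)
dilatedCount-isPoly D [] a r pos bound =
  dilatedCount-[] D a r pos (subst (λ k → SubtractionBound D k a 0) (ℕₚ.+-identityʳ r) bound)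
dilatedCount-isPoly D {suc m} (c₀ ∷ c) a r pos bound =
  subst (λ v → IsPoly D v (dilatedCount D (c₀ ∷ c) a r)) (sym (Δs-Δ c c₀ (truncatedPower D) a))
    (IsPoly-cong (λ t → sym (dilatedCount-∷ D c₀ c a r t))
      (IsPoly-- (dilatedCount-isPoly D c a r pos (kept bound′))
                (dilatedCount-isPoly D c (a - + c₀) (suc r) (inj₂ (ℕ.s≤s ℕ.z≤n)) (dropped bound′))))
  where
  bound′ : SubtractionBound D (suc (r ℕ.+ m)) a (c₀ ℕ.+ sum c)
  bound′ = subst (λ k → SubtractionBound D k a (c₀ ℕ.+ sum c)) (ℕₚ.+-suc r m) bound
  kept : SubtractionBound D (suc (r ℕ.+ m)) a (c₀ ℕ.+ sum c) → SubtractionBound D (r ℕ.+ m) a (sum c)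
  kept (inj₁ 1+r+m≤D)   = inj₁ (ℕₚ.<⇒≤ 1+r+m≤D)
  kept (inj₂ (eq , _)) = inj₁ (ℕₚ.≤-reflexive (ℕₚ.suc-injective eq))
  dropped : SubtractionBound D (suc (r ℕ.+ m)) a (c₀ ℕ.+ sum c) → SubtractionBound D (suc r ℕ.+ m) (a - + c₀) (sum c)
  dropped (inj₁ le)        = inj₁ le
  dropped (inj₂ (eq , lt)) = inj₂ (eq , subst (a - + c₀ ℤ.<_) (cancel (+ c₀) (+ sum c))
                                          (+-monoˡ-< (- + c₀) (subst (a ℤ.<_) (pos-+ c₀ (sum c)) lt)))
    where
    cancel : ∀ c s → c + s - c ≡ s
    cancel = solve-∀

𝟙 : Bool → ℕ
𝟙 b = if b then 1 else 0

length-filterᵇ : ∀ {X : Set} (p : X → Bool) xs → length (filterᵇ p xs) ≡ ℕ.sum (map (λ x → 𝟙 (p x)) xs)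
length-filterᵇ p []       = refl
length-filterᵇ p (x ∷ xs) with p x
... | true  = cong suc (length-filterᵇ p xs)
... | false = length-filterᵇ p xs

sum-map-concatMap : ∀ {X Y : Set} (g : Y → ℕ) (F : X → List Y) xs →
                    ℕ.sum (map g (concatMap F xs)) ≡ ℕ.sum (map (λ x → ℕ.sum (map g (F x))) xs)
sum-map-concatMap g F []       = refl
sum-map-concatMap g F (x ∷ xs) = begin
  ℕ.sum (map g (F x ++ concatMap F xs))                  ≡⟨ cong ℕ.sum (List.map-++ g (F x) (concatMap F xs)) ⟩
  ℕ.sum (map g (F x) ++ map g (concatMap F xs))          ≡⟨ ℕₚ.sum-++ (map g (F x)) _ ⟩
  ℕ.sum (map g (F x)) ℕ.+ ℕ.sum (map g (concatMap F xs))   ≡⟨ cong (ℕ.sum (map g (F x)) ℕ.+_) (sum-map-concatMap g F xs) ⟩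
  ℕ.sum (map (λ x → ℕ.sum (map g (F x))) (x ∷ xs))         ∎

sum-map-+ : ∀ {X : Set} (f g : X → ℕ) xs → ℕ.sum (map (λ x → f x ℕ.+ g x) xs) ≡ ℕ.sum (map f xs) ℕ.+ ℕ.sum (map g xs)
sum-map-+ f g []       = refl
sum-map-+ f g (x ∷ xs) = trans (cong (f x ℕ.+ g x ℕ.+_) (sum-map-+ f g xs)) (swap (f x) (g x) _ _)
  where
  swap : ∀ a b c d → a ℕ.+ b ℕ.+ (c ℕ.+ d) ≡ a ℕ.+ c ℕ.+ (b ℕ.+ d)
  swap = ℕ-solve-∀

sum-map-weighted-𝟙 : ∀ {X : Set} (u : X → ℕ) (h : ℕ → ℕ) j xs →
                     ℕ.sum (map (λ x → h (u x) ℕ.* 𝟙 (u x ℕ.≡ᵇ j)) xs) ≡ h j ℕ.* length (filterᵇ (λ x → u x ℕ.≡ᵇ j) xs)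
sum-map-weighted-𝟙 u h j []       = sym (ℕₚ.*-zeroʳ (h j))
sum-map-weighted-𝟙 u h j (x ∷ xs) with u x ℕ.≡ᵇ j in ux≡ᵇj
... | true  = begin
  h (u x) ℕ.* 1 ℕ.+ ℕ.sum (map (λ x → h (u x) ℕ.* 𝟙 (u x ℕ.≡ᵇ j)) xs)   ≡⟨ cong₂ ℕ._+_ (trans (ℕₚ.*-identityʳ (h (u x))) (cong h ux≡j)) (sum-map-weighted-𝟙 u h j xs) ⟩
  h j ℕ.+ h j ℕ.* length (filterᵇ (λ x → u x ℕ.≡ᵇ j) xs)              ≡⟨ ℕₚ.*-suc (h j) _ ⟨
  h j ℕ.* suc (length (filterᵇ (λ x → u x ℕ.≡ᵇ j) xs))                ∎
  where
  ux≡j : u x ≡ j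
  ux≡j = ℕₚ.≡ᵇ⇒≡ (u x) j (subst T (sym ux≡ᵇj) tt)
... | false = trans (cong (ℕ._+ ℕ.sum (map (λ x → h (u x) ℕ.* 𝟙 (u x ℕ.≡ᵇ j)) xs)) (ℕₚ.*-zeroʳ (h (u x)))) (sum-map-weighted-𝟙 u h j xs)

sum-map-zero : ∀ {X : Set} (xs : List X) → ℕ.sum (map (λ _ → 0) xs) ≡ 0
sum-map-zero []       = refl
sum-map-zero (_ ∷ xs) = sum-map-zero xs

+-sum-upTo : ∀ (F : ℕ → ℕ) n → + ℕ.sum (map F (upTo n)) ≡ ∑[ j < n ] + F j
+-sum-upTo F zero    = refl
+-sum-upTo F (suc n) = begin
  + ℕ.sum (map F (upTo (suc n)))                    ≡⟨ cong (λ js → + ℕ.sum (map F js)) (List.applyUpTo-∷ʳ (λ j → j) n) ⟨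
  + ℕ.sum (map F (upTo n List.∷ʳ n))                ≡⟨ cong (λ xs → + ℕ.sum xs) (List.map-++ F (upTo n) (n ∷ [])) ⟩
  + ℕ.sum (map F (upTo n) ++ F n ∷ [])              ≡⟨ cong +_ (trans (ℕₚ.sum-++ (map F (upTo n)) (F n ∷ [])) (cong (ℕ.sum (map F (upTo n)) ℕ.+_) (ℕₚ.+-identityʳ (F n)))) ⟩
  + (ℕ.sum (map F (upTo n)) ℕ.+ F n)                ≡⟨ pos-+ (ℕ.sum (map F (upTo n))) (F n) ⟩
  + ℕ.sum (map F (upTo n)) + + F n                  ≡⟨ cong (_+ + F n) (+-sum-upTo F n) ⟩
  (∑[ j < n ] + F j) + + F n                       ∎

boundedCount-vanishes : ∀ {m} (bs : Vec ℕ m) → VanishesOnNegatives (boundedCount bs)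
boundedCount-vanishes []       n = refl
boundedCount-vanishes (b ∷ bs) n =
  trans (∑-cong (suc b) (λ j → trans (cong (boundedCount bs) (neg-minus-pos n j)) (boundedCount-vanishes bs (j ℕ.+ n))))
        (∑-zero (suc b))

+-≡ᵇ-≤ : ∀ j m s → j ℕ.≤ m → (j ℕ.+ s ℕ.≡ᵇ m) ≡ (s ℕ.≡ᵇ (m ℕ.∸ j))
+-≡ᵇ-≤ zero    m       s _           = refl
+-≡ᵇ-≤ (suc j) (suc m) s (ℕ.s≤s j≤m) = +-≡ᵇ-≤ j m s j≤m

+-≡ᵇ-> : ∀ j m s → m ℕ.< j → (j ℕ.+ s ℕ.≡ᵇ m) ≡ false
+-≡ᵇ-> (suc j) zero    s _           = refl
+-≡ᵇ-> (suc j) (suc m) s (ℕ.s≤s m<j) = +-≡ᵇ-> j m s m<j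

countBounded≡boundedCount : ∀ {n} (caps : Vec ℕ n) m → + countBounded caps m ≡ boundedCount caps (+ m)
countBounded≡boundedCount []       zero    = refl
countBounded≡boundedCount []       (suc m) = refl
countBounded≡boundedCount (c ∷ cs) m = begin
  + length (filterᵇ p (concatMap prepend (upTo (suc c))))                               ≡⟨ cong +_ (length-filterᵇ p (concatMap prepend (upTo (suc c)))) ⟩
  + ℕ.sum (map (λ b → 𝟙 (p b)) (concatMap prepend (upTo (suc c))))                       ≡⟨ cong +_ (sum-map-concatMap (λ b → 𝟙 (p b)) prepend (upTo (suc c))) ⟩
  + ℕ.sum (map (λ j → ℕ.sum (map (λ b → 𝟙 (p b)) (map (j ∷_) (boundedVecs cs)))) (upTo (suc c))) ≡⟨ +-sum-upTo _ (suc c) ⟩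
  ∑[ j < suc c ] + ℕ.sum (map (λ b → 𝟙 (p b)) (map (j ∷_) (boundedVecs cs)))            ≡⟨ ∑-cong (suc c) first-entry ⟩
  ∑[ j < suc c ] boundedCount cs (+ m - + j)                                          ∎
  where
  p : Vec ℕ _ → Bool
  p b = sum b ℕ.≡ᵇ m
  prepend : ℕ → List (Vec ℕ _)
  prepend j = map (j ∷_) (boundedVecs cs)
  first-entry : ∀ j → + ℕ.sum (map (λ b → 𝟙 (p b)) (map (j ∷_) (boundedVecs cs))) ≡ boundedCount cs (+ m - + j)
  first-entry j with ℕₚ.≤-<-connex j m
  ... | inj₁ j≤m = begin
    + ℕ.sum (map (λ b → 𝟙 (p b)) (map (j ∷_) (boundedVecs cs)))             ≡⟨ cong (λ xs → + ℕ.sum xs) (List.map-∘ (boundedVecs cs)) ⟨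
    + ℕ.sum (map (λ b → 𝟙 (j ℕ.+ sum b ℕ.≡ᵇ m)) (boundedVecs cs))       ≡⟨ cong (λ xs → + ℕ.sum xs) (List.map-cong (λ b → cong 𝟙 (+-≡ᵇ-≤ j m (sum b) j≤m)) (boundedVecs cs)) ⟩
    + ℕ.sum (map (λ b → 𝟙 (sum b ℕ.≡ᵇ m ℕ.∸ j)) (boundedVecs cs))       ≡⟨ cong +_ (length-filterᵇ _ (boundedVecs cs)) ⟨
    + countBounded cs (m ℕ.∸ j)                                           ≡⟨ countBounded≡boundedCount cs (m ℕ.∸ j) ⟩
    boundedCount cs (+ (m ℕ.∸ j))                                         ≡⟨ cong (boundedCount cs) (trans (m-n≡m⊖n m j) (⊖-≥ j≤m)) ⟨
    boundedCount cs (+ m - + j)                                           ∎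
  ... | inj₂ m<j = begin
    + ℕ.sum (map (λ b → 𝟙 (p b)) (map (j ∷_) (boundedVecs cs)))             ≡⟨ cong (λ xs → + ℕ.sum xs) (List.map-∘ (boundedVecs cs)) ⟨
    + ℕ.sum (map (λ b → 𝟙 (j ℕ.+ sum b ℕ.≡ᵇ m)) (boundedVecs cs))       ≡⟨ cong (λ xs → + ℕ.sum xs) (List.map-cong (λ b → cong 𝟙 (+-≡ᵇ-> j m (sum b) m<j)) (boundedVecs cs)) ⟩
    + ℕ.sum (map (λ _ → 0) (boundedVecs cs))                                ≡⟨ cong +_ (sum-map-zero (boundedVecs cs)) ⟩
    + 0                                                                   ≡⟨ vanishes-below-zero (boundedCount cs) (boundedCount-vanishes cs) m-j<0 ⟨
    boundedCount cs (+ m - + j)                                           ∎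
    where
    m-j<0 : + m - + j ℤ.< + 0
    m-j<0 = subst (+ m - + j ℤ.<_) (+-inverseʳ (+ j)) (+-monoˡ-< (- + j) (+<+ m<j))

-- Eulerian numbers

insertAll-map-suc : ∀ x τ → insertAll (suc x) (map suc τ) ≡ map (map suc) (insertAll x τ)
insertAll-map-suc x []       = refl
insertAll-map-suc x (y ∷ ys) = cong ((suc x ∷ suc y ∷ map suc ys) ∷_) (begin
  map (suc y ∷_) (insertAll (suc x) (map suc ys))   ≡⟨ cong (map (suc y ∷_)) (insertAll-map-suc x ys) ⟩
  map (suc y ∷_) (map (map suc) (insertAll x ys))   ≡⟨ List.map-∘ (insertAll x ys) ⟨
  map (λ ρ → suc y ∷ map suc ρ) (insertAll x ys)    ≡⟨ List.map-∘ (insertAll x ys) ⟩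
  map (map suc) (map (y ∷_) (insertAll x ys))       ∎)

perms-map-suc : ∀ xs → perms (map suc xs) ≡ map (map suc) (perms xs)
perms-map-suc []       = refl
perms-map-suc (x ∷ xs) = begin
  concatMap (insertAll (suc x)) (perms (map suc xs))          ≡⟨ cong (concatMap (insertAll (suc x))) (perms-map-suc xs) ⟩
  concatMap (insertAll (suc x)) (map (map suc) (perms xs))    ≡⟨ List.concatMap-map (insertAll (suc x)) (map suc) (perms xs) ⟩
  concatMap (λ τ → insertAll (suc x) (map suc τ)) (perms xs)  ≡⟨ List.concatMap-cong (insertAll-map-suc x) (perms xs) ⟩
  concatMap (λ τ → map (map suc) (insertAll x τ)) (perms xs)  ≡⟨ List.map-concatMap (map suc) (insertAll x) (perms xs) ⟨
  map (map suc) (concatMap (insertAll x) (perms xs))          ∎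

perms-upTo-suc : ∀ m → perms (upTo (suc m)) ≡ concatMap (λ τ → insertAll 0 (map suc τ)) (perms (upTo m))
perms-upTo-suc m = begin
  concatMap (insertAll 0) (perms (List.applyUpTo suc m))       ≡⟨ cong (λ xs → concatMap (insertAll 0) (perms xs)) (List.map-upTo suc m) ⟨
  concatMap (insertAll 0) (perms (map suc (upTo m)))           ≡⟨ cong (concatMap (insertAll 0)) (perms-map-suc (upTo m)) ⟩
  concatMap (insertAll 0) (map (map suc) (perms (upTo m)))     ≡⟨ List.concatMap-map (insertAll 0) (map suc) (perms (upTo m)) ⟩
  concatMap (λ τ → insertAll 0 (map suc τ)) (perms (upTo m))   ∎

perms-length : ∀ xs → All.All (λ τ → length τ ≡ length xs) (perms xs)
perms-length []       = refl ∷ []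
perms-length (x ∷ xs) = All.concat⁺ (All.map⁺ (All.map insertions-length (perms-length xs)))
  where
  insertAll-length : ∀ τ → All.All (λ σ → length σ ≡ suc (length τ)) (insertAll x τ)
  insertAll-length []       = refl ∷ []
  insertAll-length (y ∷ ys) = refl ∷ All.map⁺ (All.map (cong suc) (insertAll-length ys))
  insertions-length : ∀ {τ} → length τ ≡ length xs → All.All (λ σ → length σ ≡ length (x ∷ xs)) (insertAll x τ)
  insertions-length {τ} |τ|≡|xs| = All.map (λ |σ|≡1+|τ| → trans |σ|≡1+|τ| (cong suc |τ|≡|xs|)) (insertAll-length τ)

descents-map-suc : ∀ τ → descents (map suc τ) ≡ descents τ
descents-map-suc []           = refl
descents-map-suc (x ∷ [])     = refl
descents-map-suc (x ∷ y ∷ ys) = cong (𝟙 (y ℕ.<ᵇ x) ℕ.+_) (descents-map-suc (y ∷ ys))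

ascents : List ℕ → ℕ
ascents []           = 0
ascents (x ∷ [])     = 0
ascents (x ∷ y ∷ ys) = (if y ℕ.<ᵇ x then 0 else 1) ℕ.+ ascents (y ∷ ys)

ascents+descents : ∀ x ys → ascents (x ∷ ys) ℕ.+ descents (x ∷ ys) ≡ length ys
ascents+descents x []       = refl
ascents+descents x (y ∷ ys) with y ℕ.<ᵇ x
... | true  = trans (ℕₚ.+-suc (ascents (y ∷ ys)) (descents (y ∷ ys))) (cong suc (ascents+descents y ys))
... | false = cong suc (ascents+descents y ys)

-- Inserting the new minimum 0 into a descent of w keeps its descent count d; inserting it into an ascent or at
-- the end raises the count to d + 1.
insertAll-0-descents-behind : ∀ (g : ℕ → ℕ) y τ →
  let w = suc y ∷ map suc τ in
  ℕ.sum (map (λ ρ → g (descents (suc y ∷ ρ))) (insertAll 0 (map suc τ))) ≡ descents w ℕ.* g (descents w) ℕ.+ suc (ascents w) ℕ.* g (suc (descents w))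
insertAll-0-descents-behind g y []       = refl
insertAll-0-descents-behind g y (z ∷ zs) = begin
  g (suc D) ℕ.+ ℕ.sum (map (λ ρ → g (descents (suc y ∷ ρ))) (map (suc z ∷_) X))          ≡⟨ cong (g (suc D) ℕ.+_) (cong ℕ.sum (List.map-∘ X)) ⟨
  g (suc D) ℕ.+ ℕ.sum (map (λ ρ → g (𝟙 (z ℕ.<ᵇ y) ℕ.+ descents (suc z ∷ ρ))) X)          ≡⟨ cong (g (suc D) ℕ.+_) (insertAll-0-descents-behind (λ k → g (𝟙 (z ℕ.<ᵇ y) ℕ.+ k)) z zs) ⟩
  g (suc D) ℕ.+ (D ℕ.* g (𝟙 (z ℕ.<ᵇ y) ℕ.+ D) ℕ.+ suc a ℕ.* g (𝟙 (z ℕ.<ᵇ y) ℕ.+ suc D)) ≡⟨ case (z ℕ.<ᵇ y) ⟩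
  d ℕ.* g d ℕ.+ suc (ascents (suc y ∷ suc z ∷ map suc zs)) ℕ.* g (suc d)                ∎
  where
  X = insertAll 0 (map suc zs)
  D = descents (suc z ∷ map suc zs)
  a = ascents (suc z ∷ map suc zs)
  d = 𝟙 (z ℕ.<ᵇ y) ℕ.+ D
  case : ∀ b → g (suc D) ℕ.+ (D ℕ.* g (𝟙 b ℕ.+ D) ℕ.+ suc a ℕ.* g (𝟙 b ℕ.+ suc D)) ≡
               (𝟙 b ℕ.+ D) ℕ.* g (𝟙 b ℕ.+ D) ℕ.+ suc ((if b then 0 else 1) ℕ.+ a) ℕ.* g (suc (𝟙 b ℕ.+ D))
  case true  = sym (ℕₚ.+-assoc (g (suc D)) (D ℕ.* g (suc D)) _)
  case false = left-comm (g (suc D)) (D ℕ.* g D) (suc a ℕ.* g (suc D))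
    where
    left-comm : ∀ x p q → x ℕ.+ (p ℕ.+ q) ≡ p ℕ.+ (x ℕ.+ q)
    left-comm = ℕ-solve-∀

insertAll-0-descents : ∀ (g : ℕ → ℕ) τ →
  ℕ.sum (map (λ ρ → g (descents ρ)) (insertAll 0 (map suc τ))) ≡ suc (descents τ) ℕ.* g (descents τ) ℕ.+ (length τ ℕ.∸ descents τ) ℕ.* g (suc (descents τ))
insertAll-0-descents g []       = sym (ℕₚ.+-identityʳ (g 0 ℕ.+ 0))
insertAll-0-descents g (y ∷ ys) = begin
  g D ℕ.+ ℕ.sum (map (λ ρ → g (descents ρ)) (map (suc y ∷_) X))     ≡⟨ cong (g D ℕ.+_) (cong ℕ.sum (List.map-∘ X)) ⟨
  g D ℕ.+ ℕ.sum (map (λ ρ → g (descents (suc y ∷ ρ))) X)            ≡⟨ cong (g D ℕ.+_) (insertAll-0-descents-behind g y ys) ⟩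
  g D ℕ.+ (D ℕ.* g D ℕ.+ suc a ℕ.* g (suc D))                      ≡⟨ ℕₚ.+-assoc (g D) (D ℕ.* g D) _ ⟨
  suc D ℕ.* g D ℕ.+ suc a ℕ.* g (suc D)                            ≡⟨ cong₂ (λ e k → suc e ℕ.* g e ℕ.+ k ℕ.* g (suc e)) descents-w (sym length∸D) ⟩
  suc (descents (y ∷ ys)) ℕ.* g (descents (y ∷ ys)) ℕ.+ (suc (length ys) ℕ.∸ descents (y ∷ ys)) ℕ.* g (suc (descents (y ∷ ys))) ∎
  where
  X = insertAll 0 (map suc ys)
  D = descents (suc y ∷ map suc ys)
  a = ascents (suc y ∷ map suc ys)
  descents-w : D ≡ descents (y ∷ ys)
  descents-w = descents-map-suc (y ∷ ys)
  length∸D : suc (length ys) ℕ.∸ descents (y ∷ ys) ≡ suc a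
  length∸D = begin
    suc (length ys) ℕ.∸ descents (y ∷ ys)                   ≡⟨ cong₂ (λ l e → suc l ℕ.∸ e) (List.length-map suc ys) descents-w ⟨
    suc (length (map suc ys)) ℕ.∸ D                          ≡⟨ cong (λ l → suc l ℕ.∸ D) (ascents+descents (suc y) (map suc ys)) ⟨
    suc (a ℕ.+ D) ℕ.∸ D                                      ≡⟨ ℕₚ.m+n∸n≡m (suc a) D ⟩
    suc a                                                    ∎

A-suc : ∀ m j → A (suc m) j ≡ suc j ℕ.* A m j ℕ.+ ℕ.sum (map (λ τ → (m ℕ.∸ descents τ) ℕ.* 𝟙 (suc (descents τ) ℕ.≡ᵇ j)) (perms (upTo m)))
A-suc m j = begin
  length (filterᵇ p (perms (upTo (suc m))))                               ≡⟨ length-filterᵇ p (perms (upTo (suc m))) ⟩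
  ℕ.sum (map (λ σ → 𝟙 (p σ)) (perms (upTo (suc m))))                        ≡⟨ cong (λ σs → ℕ.sum (map (λ σ → 𝟙 (p σ)) σs)) (perms-upTo-suc m) ⟩
  ℕ.sum (map (λ σ → 𝟙 (p σ)) (concatMap (λ τ → insertAll 0 (map suc τ)) P)) ≡⟨ sum-map-concatMap (λ σ → 𝟙 (p σ)) (λ τ → insertAll 0 (map suc τ)) P ⟩
  ℕ.sum (map (λ τ → ℕ.sum (map (λ σ → 𝟙 (p σ)) (insertAll 0 (map suc τ)))) P) ≡⟨ cong ℕ.sum (List.map-cong-local all-insertions) ⟩
  ℕ.sum (map (λ τ → kept τ ℕ.+ raised τ) P)                                 ≡⟨ sum-map-+ kept raised P ⟩
  ℕ.sum (map kept P) ℕ.+ ℕ.sum (map raised P)                                 ≡⟨ cong (ℕ._+ ℕ.sum (map raised P)) (sum-map-weighted-𝟙 descents suc j P) ⟩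
  suc j ℕ.* A m j ℕ.+ ℕ.sum (map raised P)                                  ∎
  where
  P = perms (upTo m)
  p : List ℕ → Bool
  p σ = descents σ ℕ.≡ᵇ j
  kept raised : List ℕ → ℕ
  kept τ   = suc (descents τ) ℕ.* 𝟙 (descents τ ℕ.≡ᵇ j)
  raised τ = (m ℕ.∸ descents τ) ℕ.* 𝟙 (suc (descents τ) ℕ.≡ᵇ j)
  Splits : List ℕ → Set
  Splits τ = ℕ.sum (map (λ σ → 𝟙 (p σ)) (insertAll 0 (map suc τ))) ≡ kept τ ℕ.+ raised τ
  insertions : ∀ {τ} → length τ ≡ length (upTo m) → Splits τ
  insertions {τ} |τ|≡m = trans (insertAll-0-descents (λ e → 𝟙 (e ℕ.≡ᵇ j)) τ)
    (cong (λ l → kept τ ℕ.+ (l ℕ.∸ descents τ) ℕ.* 𝟙 (suc (descents τ) ℕ.≡ᵇ j)) (trans |τ|≡m (List.length-upTo m)))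
  all-insertions : All.All Splits P
  all-insertions = All.map {P = λ τ → length τ ≡ length (upTo m)} {Q = Splits} (λ {τ} → insertions {τ}) (perms-length (upTo m))

A-suc-zero : ∀ m → A (suc m) 0 ≡ A m 0
A-suc-zero m = begin
  A (suc m) 0                                                                ≡⟨ A-suc m 0 ⟩
  1 ℕ.* A m 0 ℕ.+ ℕ.sum (map (λ τ → (m ℕ.∸ descents τ) ℕ.* 0) (perms (upTo m))) ≡⟨ cong (1 ℕ.* A m 0 ℕ.+_) (trans (cong ℕ.sum (List.map-cong (λ τ → ℕₚ.*-zeroʳ (m ℕ.∸ descents τ)) (perms (upTo m)))) (sum-map-zero (perms (upTo m)))) ⟩
  1 ℕ.* A m 0 ℕ.+ 0                                                          ≡⟨ trans (ℕₚ.+-identityʳ _) (ℕₚ.*-identityˡ (A m 0)) ⟩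
  A m 0                                                                      ∎

A-suc-suc : ∀ m i → A (suc m) (suc i) ≡ suc (suc i) ℕ.* A m (suc i) ℕ.+ (m ℕ.∸ i) ℕ.* A m i
A-suc-suc m i = trans (A-suc m (suc i)) (cong (suc (suc i) ℕ.* A m (suc i) ℕ.+_) (sum-map-weighted-𝟙 descents (m ℕ.∸_) i (perms (upTo m))))

A-vanishes : ∀ D i → D ℕ.< i → A D i ≡ 0
A-vanishes zero    (suc i) _           = refl
A-vanishes (suc D) (suc i) (ℕ.s≤s D<i) = begin
  A (suc D) (suc i)                                         ≡⟨ A-suc-suc D i ⟩
  suc (suc i) ℕ.* A D (suc i) ℕ.+ (D ℕ.∸ i) ℕ.* A D i       ≡⟨ cong₂ (λ x y → suc (suc i) ℕ.* x ℕ.+ y ℕ.* A D i) (A-vanishes D (suc i) (ℕₚ.m<n⇒m<1+n D<i)) (ℕₚ.m≤n⇒m∸n≡0 (ℕₚ.<⇒≤ D<i)) ⟩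
  suc (suc i) ℕ.* 0 ℕ.+ 0                                   ≡⟨ trans (ℕₚ.+-identityʳ _) (ℕₚ.*-zeroʳ (suc (suc i))) ⟩
  0                                                         ∎

-- Worpitzky's identity

worpitzky-term : ∀ D K i → + suc i * + A D i * rising (suc D) (+ K - + i) + + (D ℕ.∸ i) * + A D i * rising (suc D) (+ K - + suc i)
                           ≡ + suc D * + suc K * (+ A D i * rising D (+ K - + i))
worpitzky-term D K i with ℕₚ.≤-<-connex i D
... | inj₂ D<i rewrite A-vanishes D i D<i = vanish (+ suc i) (rising (suc D) (+ K - + i)) (+ (D ℕ.∸ i)) (rising (suc D) (+ K - + suc i)) (+ suc D * + suc K) (rising D (+ K - + i))
  where
  vanish : ∀ s r d r′ c q → s * + 0 * r + d * + 0 * r′ ≡ c * (+ 0 * q)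
  vanish = solve-∀
... | inj₁ i≤D = begin
  + suc i * a * (r * (N + + suc D)) + + (D ℕ.∸ i) * a * rising (suc D) (+ K - + suc i) ≡⟨ cong (λ z → + suc i * a * (r * (N + + suc D)) + + (D ℕ.∸ i) * a * z) lowered ⟩
  + suc i * a * (r * (N + + suc D)) + + (D ℕ.∸ i) * a * (N * r)                        ≡⟨ cong₂ (λ u v → u * a * (r * (N + v)) + + (D ℕ.∸ i) * a * (N * r)) (pos-+ 1 i) (pos-+ 1 D) ⟩
  (+ 1 + + i) * a * (r * (N + (+ 1 + + D))) + + (D ℕ.∸ i) * a * (N * r)               ≡⟨ cong (λ w → (+ 1 + + i) * a * (r * (N + (+ 1 + + D))) + w * a * (N * r)) D∸i ⟩
  (+ 1 + + i) * a * (r * (N + (+ 1 + + D))) + (+ D - + i) * a * (N * r)               ≡⟨ collect (+ i) a r (+ K) (+ D) ⟩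
  (+ 1 + + D) * (+ 1 + + K) * (a * r)                                                  ≡⟨ cong₂ (λ u v → u * v * (a * r)) (pos-+ 1 D) (pos-+ 1 K) ⟨
  + suc D * + suc K * (a * r)                                                          ∎
  where
  a = + A D i
  N = + K - + i
  r = rising D N
  D∸i : + (D ℕ.∸ i) ≡ + D - + i
  D∸i = trans (sym (⊖-≥ i≤D)) (sym (m-n≡m⊖n D i))
  lowered : rising (suc D) (+ K - + suc i) ≡ N * r
  lowered = trans (cong (rising (suc D)) (trans (cong (λ z → + K - z) (pos-+ 1 i)) (regroup (+ K) (+ i)))) (rising-suc-pred D N)
    where
    regroup : ∀ K i → K - (+ 1 + i) ≡ K - i - + 1
    regroup = solve-∀
  collect : ∀ i a r K D → (+ 1 + i) * a * (r * (K - i + (+ 1 + D))) + (D - i) * a * ((K - i) * r) ≡ (+ 1 + D) * (+ 1 + K) * (a * r)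
  collect = solve-∀

worpitzky : ∀ D K → ∑[ j < suc K ] + A D j * rising D (+ K - + j) ≡ + (D !) * (+ suc K) ^ D
worpitzky zero    K = trans (∑-head K (λ j → + A 0 j * + 1)) (cong (λ z → + 1 + z) (∑-zero K))
worpitzky (suc D) K = begin
  ∑[ j < suc K ] + A (suc D) j * h j                                 ≡⟨ ∑-head K (λ j → + A (suc D) j * h j) ⟩
  + A (suc D) 0 * h 0 + (∑[ i < K ] + A (suc D) (suc i) * h (suc i))  ≡⟨ cong₂ _+_ (cong (λ z → + z * h 0) (A-suc-zero D)) (∑-cong K split) ⟩
  + A D 0 * h 0 + (∑[ i < K ] (X (suc i) + Y i))                      ≡⟨ cong (λ z → + A D 0 * h 0 + z) (∑-distrib-+ K (λ i → X (suc i)) Y) ⟩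
  + A D 0 * h 0 + ((∑[ i < K ] X (suc i)) + ∑ K Y)                    ≡⟨ cong (λ z → z * h 0 + ((∑[ i < K ] X (suc i)) + ∑ K Y)) (*-identityˡ (+ A D 0)) ⟨
  X 0 + ((∑[ i < K ] X (suc i)) + ∑ K Y)                              ≡⟨ +-assoc (X 0) _ (∑ K Y) ⟨
  X 0 + (∑[ i < K ] X (suc i)) + ∑ K Y                               ≡⟨ cong₂ _+_ (∑-head K X) Y-last ⟨
  ∑ (suc K) X + ∑ (suc K) Y                                          ≡⟨ ∑-distrib-+ (suc K) X Y ⟨
  ∑[ i < suc K ] (X i + Y i)                                          ≡⟨ ∑-cong (suc K) (worpitzky-term D K) ⟩
  ∑[ i < suc K ] c * (+ A D i * rising D (+ K - + i))                  ≡⟨ *-distribˡ-∑ (suc K) c _ ⟨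
  c * (∑[ i < suc K ] + A D i * rising D (+ K - + i))                  ≡⟨ cong (c *_) (worpitzky D K) ⟩
  c * (+ (D !) * (+ suc K) ^ D)                                       ≡⟨ regroup (+ suc D) (+ suc K) (+ (D !)) ((+ suc K) ^ D) ⟩
  + suc D * + (D !) * (+ suc K) ^ suc D                               ≡⟨ cong (_* (+ suc K) ^ suc D) (pos-* (suc D) (D !)) ⟨
  + (suc D !) * (+ suc K) ^ suc D                                     ∎
  where
  h : ℕ → ℤ
  h j = rising (suc D) (+ K - + j)
  X Y : ℕ → ℤ
  X i = + suc i * + A D i * h i
  Y i = + (D ℕ.∸ i) * + A D i * h (suc i)
  c = + suc D * + suc K
  regroup : ∀ d k f p → d * k * (f * p) ≡ d * f * (k * p)
  regroup = solve-∀
  split : ∀ i → + A (suc D) (suc i) * h (suc i) ≡ X (suc i) + Y i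
  split i = begin
    + A (suc D) (suc i) * h (suc i)                                               ≡⟨ cong (λ z → + z * h (suc i)) (A-suc-suc D i) ⟩
    + (suc (suc i) ℕ.* A D (suc i) ℕ.+ (D ℕ.∸ i) ℕ.* A D i) * h (suc i)          ≡⟨ cong (_* h (suc i)) (pos-+ (suc (suc i) ℕ.* A D (suc i)) ((D ℕ.∸ i) ℕ.* A D i)) ⟩
    (+ (suc (suc i) ℕ.* A D (suc i)) + + ((D ℕ.∸ i) ℕ.* A D i)) * h (suc i)      ≡⟨ cong₂ (λ u v → (u + v) * h (suc i)) (pos-* (suc (suc i)) (A D (suc i))) (pos-* (D ℕ.∸ i) (A D i)) ⟩
    (+ suc (suc i) * + A D (suc i) + + (D ℕ.∸ i) * + A D i) * h (suc i)          ≡⟨ *-distribʳ-+ (h (suc i)) (+ suc (suc i) * + A D (suc i)) (+ (D ℕ.∸ i) * + A D i) ⟩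
    X (suc i) + Y i                                                              ∎
  Y-last : ∑ (suc K) Y ≡ ∑ K Y
  Y-last = trans (cong (λ z → ∑ K Y + + (D ℕ.∸ K) * + A D K * z) h-below) (trans (cong (λ z → ∑ K Y + z) (*-zeroʳ (+ (D ℕ.∸ K) * + A D K))) (+-identityʳ (∑ K Y)))
    where
    h-below : h (suc K) ≡ + 0
    h-below = trans (cong (rising (suc D)) (trans (cong (λ z → + K - z) (pos-+ 1 K)) (K-1+K (+ K)))) (rising-vanishes (suc D) 0 (ℕ.s≤s ℕ.z≤n))
      where
      K-1+K : ∀ K → K - (+ 1 + K) ≡ -[1+ 0 ]
      K-1+K = solve-∀

convolve : (ℕ → ℤ) → (ℤ → ℤ) → ℤ → ℤ
convolve w h (+ K)    = ∑[ ℓ < K ] h (+ ℓ) * w (K ℕ.∸ ℓ ℕ.∸ 1)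
convolve w h -[1+ _ ] = + 0

convolve-cong : ∀ w {f g : ℤ → ℤ} → (∀ x → f x ≡ g x) → ∀ x → convolve w f x ≡ convolve w g x
convolve-cong w f≗g (+ K)    = ∑-cong K (λ ℓ → cong (_* w (K ℕ.∸ ℓ ℕ.∸ 1)) (f≗g (+ ℓ)))
convolve-cong w f≗g -[1+ n ] = refl

convolve-distrib-- : ∀ w (f g : ℤ → ℤ) x → convolve w (λ y → f y - g y) x ≡ convolve w f x - convolve w g x
convolve-distrib-- w f g (+ K)    = trans (∑-cong K (λ ℓ → *-distribʳ-- (w (K ℕ.∸ ℓ ℕ.∸ 1)) (f (+ ℓ)) (g (+ ℓ))))
                                          (∑-distrib-- K (λ ℓ → f (+ ℓ) * w (K ℕ.∸ ℓ ℕ.∸ 1)) (λ ℓ → g (+ ℓ) * w (K ℕ.∸ ℓ ℕ.∸ 1)))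
  where
  *-distribʳ-- : ∀ a x y → (x - y) * a ≡ x * a - y * a
  *-distribʳ-- = solve-∀
convolve-distrib-- w f g -[1+ n ] = refl

shift-vanishes : ∀ (f : ℤ → ℤ) → VanishesOnNegatives f → ∀ s → VanishesOnNegatives (λ y → f (y - + s))
shift-vanishes f f<0≡0 s n = trans (cong f (neg-minus-pos n s)) (f<0≡0 (s ℕ.+ n))

Δ-vanishes : ∀ b (f : ℤ → ℤ) → VanishesOnNegatives f → VanishesOnNegatives (Δ b f)
Δ-vanishes b f f<0≡0 n = cong₂ _-_ (f<0≡0 n) (shift-vanishes f f<0≡0 b n)

convolve-shift-1 : ∀ w (f : ℤ → ℤ) → VanishesOnNegatives f → ∀ x → convolve w (λ y → f (y - + 1)) x ≡ convolve w f (x - + 1)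
convolve-shift-1 w f f<0≡0 (+ zero)  = refl
convolve-shift-1 w f f<0≡0 +[1+ K ]  = begin
  ∑[ ℓ < suc K ] f (+ ℓ - + 1) * w (suc K ℕ.∸ ℓ ℕ.∸ 1)                          ≡⟨ ∑-head K (λ ℓ → f (+ ℓ - + 1) * w (suc K ℕ.∸ ℓ ℕ.∸ 1)) ⟩
  f -[1+ 0 ] * w K + (∑[ ℓ < K ] f (+ suc ℓ - + 1) * w (K ℕ.∸ ℓ ℕ.∸ 1))        ≡⟨ cong₂ _+_ (trans (cong (_* w K) (f<0≡0 0)) (*-zeroˡ (w K)))
                                                                                        (∑-cong K (λ ℓ → cong (λ z → f z * w (K ℕ.∸ ℓ ℕ.∸ 1)) (1+n-1≡n ℓ))) ⟩
  + 0 + convolve w f (+ K)                                                      ≡⟨ +-identityˡ _ ⟩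
  convolve w f (+ K)                                                            ≡⟨ cong (convolve w f) (1+n-1≡n K) ⟨
  convolve w f (+ suc K - + 1)                                                  ∎
convolve-shift-1 w f f<0≡0 -[1+ n ]  = sym (cong (convolve w f) (neg-minus-pos n 1))

convolve-shift : ∀ w (f : ℤ → ℤ) → VanishesOnNegatives f → ∀ s x → convolve w (λ y → f (y - + s)) x ≡ convolve w f (x - + s)
convolve-shift w f f<0≡0 zero    x = trans (convolve-cong w (λ y → cong f (+-identityʳ y)) x) (cong (convolve w f) (sym (+-identityʳ x)))
convolve-shift w f f<0≡0 (suc s) x = begin
  convolve w (λ y → f (y - + suc s)) x      ≡⟨ convolve-cong w (λ y → cong f (split y)) x ⟩
  convolve w (λ y → f (y - + 1 - + s)) x    ≡⟨ convolve-shift-1 w (λ y → f (y - + s)) (shift-vanishes f f<0≡0 s) x ⟩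
  convolve w (λ y → f (y - + s)) (x - + 1)  ≡⟨ convolve-shift w f f<0≡0 s (x - + 1) ⟩
  convolve w f (x - + 1 - + s)              ≡⟨ cong (convolve w f) (split x) ⟨
  convolve w f (x - + suc s)                ∎
  where
  regroup : ∀ y s → y - (+ 1 + s) ≡ y - + 1 - s
  regroup = solve-∀
  split : ∀ y → y - + suc s ≡ y - + 1 - + s
  split y = trans (cong (λ z → y - z) (pos-+ 1 s)) (regroup y (+ s))

convolve-Δs : ∀ w {m} (bs : Vec ℕ m) (f : ℤ → ℤ) → VanishesOnNegatives f → ∀ x → convolve w (Δs bs f) x ≡ Δs bs (convolve w f) x
convolve-Δs w []       f f<0≡0 x = refl
convolve-Δs w (b ∷ bs) f f<0≡0 x = trans (convolve-Δs w bs (Δ b f) (Δ-vanishes b f f<0≡0) x)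
  (Δs-cong bs (λ y → trans (convolve-distrib-- w f (λ z → f (z - + b)) y) (cong (λ z → convolve w f y - z) (convolve-shift w f f<0≡0 b y))) x)

convolve-compositions : ∀ D x → convolve (λ j → + A D j) (compositions (suc D)) x ≡ truncatedPower D x
convolve-compositions D (+ zero)  = refl
convolve-compositions D +[1+ K ]  = *-cancelˡ-≡ (+ (D !)) _ _ {{ℕₚ._!≢0 D}} (begin
  + (D !) * (∑[ ℓ < suc K ] compositions (suc D) (+ ℓ) * a ℓ)   ≡⟨ *-distribˡ-∑ (suc K) (+ (D !)) _ ⟩
  ∑[ ℓ < suc K ] + (D !) * (compositions (suc D) (+ ℓ) * a ℓ)   ≡⟨ ∑-cong (suc K) (λ ℓ → trans (sym (*-assoc (+ (D !)) _ _)) (cong (_* a ℓ) (sym (rising≡!*compositions D ℓ)))) ⟩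
  ∑[ ℓ < suc K ] rising D (+ ℓ) * a ℓ                           ≡⟨ ∑-reverse (suc K) (λ ℓ → rising D (+ ℓ) * a ℓ) ⟩
  ∑[ j < suc K ] rising D (+ (K ℕ.∸ j)) * a (K ℕ.∸ j)           ≡⟨ ∑-cong-< (suc K) (λ j j<1+K → reflect j (ℕₚ.≤-pred j<1+K)) ⟩
  ∑[ j < suc K ] + A D j * rising D (+ K - + j)                 ≡⟨ worpitzky D K ⟩
  + (D !) * (+ suc K) ^ D                                       ∎)
  where
  a : ℕ → ℤ
  a ℓ = + A D (suc K ℕ.∸ ℓ ℕ.∸ 1)
  reflect : ∀ j → j ℕ.≤ K → rising D (+ (K ℕ.∸ j)) * a (K ℕ.∸ j) ≡ + A D j * rising D (+ K - + j)
  reflect j j≤K = trans (*-comm (rising D (+ (K ℕ.∸ j))) (a (K ℕ.∸ j))) (cong₂ (λ u v → + A D u * rising D v) index argument)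
    where
    index : suc K ℕ.∸ (K ℕ.∸ j) ℕ.∸ 1 ≡ j
    index = trans (ℕₚ.∸-+-assoc (suc K) (K ℕ.∸ j) 1) (trans (cong (suc K ℕ.∸_) (ℕₚ.+-comm (K ℕ.∸ j) 1)) (ℕₚ.m∸[m∸n]≡n j≤K))
    argument : + (K ℕ.∸ j) ≡ + K - + j
    argument = sym (trans (m-n≡m⊖n K j) (⊖-≥ j≤K))
convolve-compositions D -[1+ n ]  = refl

fromℚᵘ-homo-+ : ∀ p q → ℚ.fromℚᵘ (p ℚᵘ.+ q) ≡ ℚ.fromℚᵘ p ℚ.+ ℚ.fromℚᵘ q
fromℚᵘ-homo-+ p q = ℚₚ.toℚᵘ-injective (ℚᵘₚ.≃-trans (ℚₚ.toℚᵘ-fromℚᵘ (p ℚᵘ.+ q))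
  (ℚᵘₚ.≃-sym (ℚᵘₚ.≃-trans (ℚₚ.toℚᵘ-homo-+ (ℚ.fromℚᵘ p) (ℚ.fromℚᵘ q)) (ℚᵘₚ.+-cong (ℚₚ.toℚᵘ-fromℚᵘ p) (ℚₚ.toℚᵘ-fromℚᵘ q)))))

fromℚᵘ-homo-* : ∀ p q → ℚ.fromℚᵘ (p ℚᵘ.* q) ≡ ℚ.fromℚᵘ p ℚ.* ℚ.fromℚᵘ q
fromℚᵘ-homo-* p q = ℚₚ.toℚᵘ-injective (ℚᵘₚ.≃-trans (ℚₚ.toℚᵘ-fromℚᵘ (p ℚᵘ.* q))
  (ℚᵘₚ.≃-sym (ℚᵘₚ.≃-trans (ℚₚ.toℚᵘ-homo-* (ℚ.fromℚᵘ p) (ℚ.fromℚᵘ q)) (ℚᵘₚ.*-cong (ℚₚ.toℚᵘ-fromℚᵘ p) (ℚₚ.toℚᵘ-fromℚᵘ q)))))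

ι : ℤ → ℚ
ι x = x ℚ./ 1

ι-+ : ∀ x y → ι (x + y) ≡ ι x ℚ.+ ι y
ι-+ x y = trans (ℚₚ.fromℚᵘ-cong {ℚᵘ.mkℚᵘ (x + y) 0} {ℚᵘ.mkℚᵘ x 0 ℚᵘ.+ ℚᵘ.mkℚᵘ y 0} (ℚᵘ.*≡* (identity x y))) (fromℚᵘ-homo-+ (ℚᵘ.mkℚᵘ x 0) (ℚᵘ.mkℚᵘ y 0))
  where
  identity : ∀ x y → (x + y) * + 1 ≡ (x * + 1 + y * + 1) * + 1
  identity = solve-∀

ι-* : ∀ x y → ι (x * y) ≡ ι x ℚ.* ι y
ι-* x y = trans (ℚₚ.fromℚᵘ-cong {ℚᵘ.mkℚᵘ (x * y) 0} {ℚᵘ.mkℚᵘ x 0 ℚᵘ.* ℚᵘ.mkℚᵘ y 0} (ℚᵘ.*≡* (identity x y))) (fromℚᵘ-homo-* (ℚᵘ.mkℚᵘ x 0) (ℚᵘ.mkℚᵘ y 0))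
  where
  identity : ∀ x y → x * y * + 1 ≡ x * y * + 1
  identity = solve-∀

/-as-* : ∀ x n → x ℚ./ suc n ≡ ι x ℚ.* (+ 1 ℚ./ suc n)
/-as-* x n = trans (ℚₚ.fromℚᵘ-cong {ℚᵘ.mkℚᵘ x n} {ℚᵘ.mkℚᵘ x 0 ℚᵘ.* ℚᵘ.mkℚᵘ (+ 1) n}
                     (ℚᵘ.*≡* (trans (cong (λ k → x * + suc k) (ℕₚ.+-identityʳ n)) (identity x (+ suc n)))))
                   (fromℚᵘ-homo-* (ℚᵘ.mkℚᵘ x 0) (ℚᵘ.mkℚᵘ (+ 1) n))
  where
  identity : ∀ x d → x * d ≡ x * + 1 * d
  identity = solve-∀

ι-inverse : ∀ n → ι (+ suc n) ℚ.* (+ 1 ℚ./ suc n) ≡ ℚ.1ℚ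
ι-inverse n = trans (sym (/-as-* (+ suc n) n))
  (ℚₚ.fromℚᵘ-cong {ℚᵘ.mkℚᵘ (+ suc n) n} {ℚᵘ.mkℚᵘ (+ 1) 0} (ℚᵘ.*≡* (identity (+ suc n))))
  where
  identity : ∀ m → m * + 1 ≡ + 1 * m
  identity = solve-∀

ι-^ : ∀ x i → powℚ (ι x) i ≡ ι (x ^ i)
ι-^ x zero    = refl
ι-^ x (suc i) = trans (cong (ι x ℚ.*_) (ι-^ x i)) (sym (ι-* x (x ^ i)))

ι-sum : ∀ {d} (f : Vector ℤ d) → ι (FinSum.sum f) ≡ sumℚ (map (λ i → ι (f i)) (allFin d))
ι-sum {zero}  f = refl
ι-sum {suc d} f = trans (ι-+ (f zero) (FinSum.sum (Vector.tail f))) (cong (ι (f zero) ℚ.+_) (begin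
  ι (FinSum.sum (Vector.tail f))                          ≡⟨ ι-sum (Vector.tail f) ⟩
  sumℚ (map (λ i → ι (f (suc i))) (allFin d))             ≡⟨ cong sumℚ (List.map-tabulate (λ i → i) (λ i → ι (f (suc i)))) ⟩
  sumℚ (List.tabulate (λ i → ι (f (suc i))))              ≡⟨ cong sumℚ (List.map-tabulate suc (λ i → ι (f i))) ⟨
  sumℚ (map (λ i → ι (f i)) (List.tabulate suc))          ∎))

sumℚ-*ʳ : ∀ {X : Set} (g : X → ℚ) xs c → sumℚ (map g xs) ℚ.* c ≡ sumℚ (map (λ x → g x ℚ.* c) xs)
sumℚ-*ʳ g []       c = ℚₚ.*-zeroˡ c
sumℚ-*ʳ g (x ∷ xs) c = trans (ℚₚ.*-distribʳ-+ c (g x) (sumℚ (map g xs))) (cong (g x ℚ.* c ℚ.+_) (sumℚ-*ʳ g xs c))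

IsPoly-÷ : ∀ D F .{{_ : ℕ.NonZero F}} (C : ℕ → ℕ) X → IsPoly D (+ X) (λ t → + F * + C t) →
           Σ (Vector ℚ D) λ a → ∀ t → ℕ→ℚ (C t) ≡ ((+ X ℚ./ F) ℚ.* powℚ (ℕ→ℚ t) D) ℚ.+ sumℚ (map (λ i → a i ℚ.* powℚ (ℕ→ℚ t) (toℕ i)) (allFin D))
IsPoly-÷ D (suc n) C X (isPoly b agrees) = (λ i → b i ℚ./ suc n) , λ t → begin
  ι (+ C t)                                                  ≡⟨ trans (cong (ι (+ C t) ℚ.*_) (ι-inverse n)) (ℚₚ.*-identityʳ _) ⟨
  ι (+ C t) ℚ.* (ι (+ suc n) ℚ.* q)                          ≡⟨ reorder (ι (+ C t)) (ι (+ suc n)) q ⟩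
  ι (+ suc n) ℚ.* ι (+ C t) ℚ.* q                            ≡⟨ cong (ℚ._* q) (trans (sym (ι-* (+ suc n) (+ C t))) (cong ι (agrees t))) ⟩
  ι (+ X * (+ t) ^ D + eval b (+ t)) ℚ.* q                           ≡⟨ cong (ℚ._* q) (trans (ι-+ (+ X * (+ t) ^ D) (eval b (+ t))) (cong (ℚ._+ ι (eval b (+ t))) (ι-* (+ X) ((+ t) ^ D)))) ⟩
  (ι (+ X) ℚ.* ι ((+ t) ^ D) ℚ.+ ι (eval b (+ t))) ℚ.* q             ≡⟨ distribute (ι (+ X)) (ι ((+ t) ^ D)) (ι (eval b (+ t))) q ⟩
  ι (+ X) ℚ.* q ℚ.* ι ((+ t) ^ D) ℚ.+ ι (eval b (+ t)) ℚ.* q         ≡⟨ cong₂ ℚ._+_ (cong₂ ℚ._*_ (sym (/-as-* (+ X) n)) (sym (ι-^ (+ t) D))) (cong (ℚ._* q) (ι-sum (λ i → b i * (+ t) ^ toℕ i))) ⟩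
  (+ X ℚ./ suc n) ℚ.* powℚ (ι (+ t)) D ℚ.+ sumℚ (map (λ i → ι (b i * (+ t) ^ toℕ i)) (allFin D)) ℚ.* q
                                                             ≡⟨ cong ((+ X ℚ./ suc n) ℚ.* powℚ (ι (+ t)) D ℚ.+_) (trans (sumℚ-*ʳ _ (allFin D) q) (cong sumℚ (List.map-cong (coefficient t) (allFin D)))) ⟩
  (+ X ℚ./ suc n) ℚ.* powℚ (ι (+ t)) D ℚ.+ sumℚ (map (λ i → (b i ℚ./ suc n) ℚ.* powℚ (ι (+ t)) (toℕ i)) (allFin D)) ∎
  where
  open ℚ-Solver
  q = + 1 ℚ./ suc n
  reorder : ∀ c f i → c ℚ.* (f ℚ.* i) ≡ f ℚ.* c ℚ.* i
  reorder = solve 3 (λ c f i → c :* (f :* i) := f :* c :* i) refl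
  distribute : ∀ x p e i → (x ℚ.* p ℚ.+ e) ℚ.* i ≡ x ℚ.* i ℚ.* p ℚ.+ e ℚ.* i
  distribute = solve 4 (λ x p e i → (x :* p :+ e) :* i := x :* i :* p :+ e :* i) refl
  coefficient : ∀ t i → ι (b i * (+ t) ^ toℕ i) ℚ.* q ≡ (b i ℚ./ suc n) ℚ.* powℚ (ι (+ t)) (toℕ i)
  coefficient t i = begin
    ι (b i * (+ t) ^ toℕ i) ℚ.* q                 ≡⟨ cong (ℚ._* q) (ι-* (b i) ((+ t) ^ toℕ i)) ⟩
    ι (b i) ℚ.* ι ((+ t) ^ toℕ i) ℚ.* q           ≡⟨ solve 3 (λ b p i → b :* p :* i := b :* i :* p) refl (ι (b i)) (ι ((+ t) ^ toℕ i)) q ⟩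
    ι (b i) ℚ.* q ℚ.* ι ((+ t) ^ toℕ i)           ≡⟨ cong₂ ℚ._*_ (sym (/-as-* (b i) n)) (sym (ι-^ (+ t) (toℕ i))) ⟩
    (b i ℚ./ suc n) ℚ.* powℚ (ι (+ t)) (toℕ i)    ∎

suc∘pred-positive : ∀ {m} (c : Vec ℕ m) → All (0 <_) c → Vec.map suc (Vec.map (ℕ._∸ 1) c) ≡ c
suc∘pred-positive []          []           = refl
suc∘pred-positive (suc x ∷ c) (ℕ.s≤s _ ∷ c>0) = cong (suc x ∷_) (suc∘pred-positive c c>0)

B≡Δs-compositions : ∀ {m} (c : Vec ℕ m) → All (0 <_) c → ∀ ℓ → + B ℓ c ≡ Δs c (compositions m) (+ ℓ)
B≡Δs-compositions {m} c c>0 ℓ = begin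
  + B ℓ c                                                         ≡⟨ countBounded≡boundedCount (Vec.map (ℕ._∸ 1) c) ℓ ⟩
  boundedCount (Vec.map (ℕ._∸ 1) c) (+ ℓ)                         ≡⟨ boundedCount≡Δs-compositions (Vec.map (ℕ._∸ 1) c) (+ ℓ) ⟩
  Δs (Vec.map suc (Vec.map (ℕ._∸ 1) c)) (compositions m) (+ ℓ)   ≡⟨ cong (λ c′ → Δs c′ (compositions m) (+ ℓ)) (suc∘pred-positive c c>0) ⟩
  Δs c (compositions m) (+ ℓ)                                     ∎

volume-numerator : ∀ D (c : Vec ℕ (suc D)) k → All (0 <_) c →
                   + ℕ.sum (map (λ ℓ → B ℓ c ℕ.* A D (k ℕ.∸ ℓ ℕ.∸ 1)) (upTo k)) ≡ Δs c (truncatedPower D) (+ k)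
volume-numerator D c k c>0 = begin
  + ℕ.sum (map (λ ℓ → B ℓ c ℕ.* A D (k ℕ.∸ ℓ ℕ.∸ 1)) (upTo k))     ≡⟨ +-sum-upTo (λ ℓ → B ℓ c ℕ.* A D (k ℕ.∸ ℓ ℕ.∸ 1)) k ⟩
  ∑[ ℓ < k ] + (B ℓ c ℕ.* A D (k ℕ.∸ ℓ ℕ.∸ 1))                     ≡⟨ ∑-cong k (λ ℓ → trans (pos-* (B ℓ c) _) (cong (_* + A D (k ℕ.∸ ℓ ℕ.∸ 1)) (B≡Δs-compositions c c>0 ℓ))) ⟩
  convolve (λ j → + A D j) (Δs c (compositions (suc D))) (+ k)     ≡⟨ convolve-Δs (λ j → + A D j) c (compositions (suc D)) (compositions-vanishes (suc D)) (+ k) ⟩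
  Δs c (convolve (λ j → + A D j) (compositions (suc D))) (+ k)     ≡⟨ Δs-cong c (convolve-compositions D) (+ k) ⟩
  Δs c (truncatedPower D) (+ k)                                    ∎

dilatedCount≡ehrhartCount : ∀ D (c : Vec ℕ (suc D)) k t → dilatedCount D c (+ k) 0 t ≡ + (D !) * + ehrhartCount c k t
dilatedCount≡ehrhartCount D c k t = cong (+ (D !) *_) (sym (begin
  + countBounded (Vec.map (t ℕ.*_) c) (t ℕ.* k)                            ≡⟨ countBounded≡boundedCount (Vec.map (t ℕ.*_) c) (t ℕ.* k) ⟩
  boundedCount (Vec.map (t ℕ.*_) c) (+ (t ℕ.* k))                          ≡⟨ boundedCount≡Δs-compositions (Vec.map (t ℕ.*_) c) (+ (t ℕ.* k)) ⟩
  Δs (Vec.map suc (Vec.map (t ℕ.*_) c)) (compositions (suc D)) (+ (t ℕ.* k)) ≡⟨ cong₂ (λ c′ x → Δs c′ (compositions (suc D)) x) (sym (Vec.map-∘ suc (t ℕ.*_) c)) (trans (pos-* t k) (sym (+-identityʳ _))) ⟩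
  Δs (Vec.map (λ x → suc (t ℕ.* x)) c) (compositions (suc D)) (+ t * + k - + 0) ∎))

corollary1p5 : (n : ℕ) (c : Vec ℕ n) (k : ℕ) →
    All (0 <_) c → 0 < k → k < sum c →
    VolumeIs c k (volumeFormula c k)
corollary1p5 zero    []  k _   _   ()
corollary1p5 (suc D) c   k c>0 k>0 k<∑c =
  IsPoly-÷ D (D !) {{D ℕₚ.!≢0}} (ehrhartCount c k) _
    (subst (λ v → IsPoly D v (λ t → + (D !) * + ehrhartCount c k t)) (sym (volume-numerator D c k c>0)) ehrhart)
  where
  ehrhart : IsPoly D (Δs c (truncatedPower D) (+ k)) (λ t → + (D !) * + ehrhartCount c k t)
  ehrhart = IsPoly-cong (dilatedCount≡ehrhartCount D c k)
              (dilatedCount-isPoly D c (+ k) 0 (inj₁ (+<+ k>0)) (inj₂ (refl , +<+ k<∑c)))
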